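{- Fix $i_0\in I$. The set $\{\check{\mathtt{c}}_F: F\in\Sigma_{i_0}[I]\}$ is a basis of $\check{\mathbf{Zie}}^*[I]$.
   Context: Let $\mathbb{k}$ be a field of characteristic zero and $I$ a nonempty finite set. $\mathrm{T}^\vee_I=\{h\in\mathbb{R}I:\sum_ih_i=0\}$, and the adjoint braid arrangement consists of the hyperplanes $\{h:\sum_{i\in S}h_i=0\}$ for $\emptyset\ne S\subsetneq I$; its chambers are the adjoint chambers. For a preposet $p$ of $I$ (reflexive transitive relation; compositions $F$ are viewed as total preorders, $i_1\ge i_2$ iff the lump of $i_1$ is weakly left of that of $i_2$), $\sigma^\vee_p$ is the cone generated by the vectors $e_{i_1}-e_{i_2}$ with $i_1\ge_p i_2$, $i_1\ne i_2$, and $\check{\mathtt{c}}_p$ is the $\mathbb{k}$-valued function on adjoint chambers equal to $1$ on chambers contained in $\sigma^\vee_p$ and $0$ otherwise. $\check{\mathbf{Zie}}^*[I]$ is the span of all $\check{\mathtt{c}}_p$ (equivalently, the restriction to adjoint chambers of the span of characteristic functionals of generalized permutohedral tangent cones). $\Sigma_{i_0}[I]$ is the set of compositions of $I$ whose first lump contains $i_0$. -}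

module Defs where

open import Level using (Level; 0ℓ; _⊔_) renaming (suc to lsuc)
open import Data.Nat using (ℕ; zero; suc; _<_; _≤_)
open import Data.Fin using (Fin)
open import Data.Bool using (Bool; true; false; if_then_else_)
open import Data.Product using (Σ; ∃; _×_; _,_; proj₁; proj₂)
open import Data.Sum using (_⊎_)
open import Data.List using (List; []; _∷_; foldr)
open import Relation.Nullary using (¬_; Dec; yes; no)
open import Relation.Binary.PropositionalEquality using (_≡_)
open import Algebra.Bundles using (CommutativeRing)
open import Axiom.ExcludedMiddle using (ExcludedMiddle)
open import Data.Rational using (ℚ; 0ℚ; _<_; _≤_) renaming (_+_ to _+ℚ_; _-_ to _-ℚ_; _*_ to _*ℚ_)
open import Data.Rational using () renaming (_<_ to _<ℚ_; _≤_ to _≤ℚ_)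

natMul1 : ∀ {c ℓ} (R : CommutativeRing c ℓ) → ℕ → CommutativeRing.Carrier R
natMul1 R zero    = CommutativeRing.0# R
natMul1 R (suc m) = CommutativeRing._+_ R (CommutativeRing.1# R) (natMul1 R m)

record CharZeroField (c ℓ : Level) : Set (lsuc (c ⊔ ℓ)) where
  field
    commRing : CommutativeRing c ℓ
  open CommutativeRing commRing public
  field
    0≉1         : ¬ (0# ≈ 1#)
    inverse     : ∀ x → ¬ (x ≈ 0#) → ∃ λ y → (x * y) ≈ 1#
    charZero    : ∀ m → ¬ (natMul1 commRing (suc m) ≈ 0#)

sumℚ : ∀ {n} → (Fin n → ℚ) → ℚ
sumℚ {zero}  f = 0ℚ
sumℚ {suc n} f = f Fin.zero +ℚ sumℚ (λ i → f (Fin.suc i))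

Subset : ℕ → Set
Subset n = Fin n → Bool

subsetSum : ∀ {n} → Subset n → (Fin n → ℚ) → ℚ
subsetSum S h = sumℚ (λ i → if S i then h i else 0ℚ)

ProperNonempty : ∀ {n} → Subset n → Set
ProperNonempty S = (∃ λ i → S i ≡ true) × (∃ λ i → S i ≡ false)

InT : ∀ {n} → (Fin n → ℚ) → Set
InT h = sumℚ h ≡ 0ℚ

-- h ∈ T^∨_I lies on no hyperplane of the adjoint braid arrangement
-- (i.e. h lies in some adjoint chamber)
Generic : ∀ {n} → (Fin n → ℚ) → Set
Generic h = InT h × (∀ S → ProperNonempty S → ¬ (subsetSum S h ≡ 0ℚ))

-- generic h, h' lie in the same adjoint chamber: every hyperplane
-- functional has the same sign on them
SameChamber : ∀ {n} → (Fin n → ℚ) → (Fin n → ℚ) → Set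
SameChamber h h' = ∀ S → ProperNonempty S →
  ((0ℚ <ℚ subsetSum S h) → (0ℚ <ℚ subsetSum S h')) ×
  ((0ℚ <ℚ subsetSum S h') → (0ℚ <ℚ subsetSum S h))

record Preposet (n : ℕ) : Set₁ where
  field
    rel   : Fin n → Fin n → Set      -- rel i j  means  i ≥_p j
    refl  : ∀ i → rel i i
    trans : ∀ {i j k} → rel i j → rel j k → rel i k

-- h ∈ σ^∨_p : h is a nonnegative combination  Σ λ_{ij} (e_i − e_j)
-- over pairs i ≥_p j, i ≠ j
InCone : ∀ {n} → Preposet n → (Fin n → ℚ) → Set
InCone {n} p h = ∃ λ (lam : Fin n → Fin n → ℚ) →
    (∀ i j → 0ℚ ≤ℚ lam i j)
  × (∀ i j → (¬ Preposet.rel p i j ⊎ i ≡ j) → lam i j ≡ 0ℚ)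
  × (∀ k → h k ≡ sumℚ (λ j → lam k j) -ℚ sumℚ (λ i → lam i k))

ChamberInCone : ∀ {n} → Preposet n → (Fin n → ℚ) → Set
ChamberInCone p h = ∀ h' → Generic h' → SameChamber h h' → InCone p h'

-- the functional č_p, evaluated at the adjoint chamber containing the
-- generic point h (classical logic supplied by lem)
module _ {c ℓ} (K : CharZeroField c ℓ) (lem : ExcludedMiddle 0ℓ) where
  open CharZeroField K

  č : ∀ {n} → Preposet n → (Fin n → ℚ) → Carrier
  č p h with lem {ChamberInCone p h}
  ... | yes _ = 1#
  ... | no  _ = 0#

-- A composition of I = Fin n with k lumps: f i is the (0-based) index of
-- the lump containing i; every index below a used one is used
-- (so the lumps are exactly 0,…,k−1 and all nonempty).
record Composition (n : ℕ) : Set where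
  field
    lump : Fin n → ℕ
    noGaps : ∀ i m → m Data.Nat.< lump i → ∃ λ j → lump j ≡ m

_≐_ : ∀ {n} → Composition n → Composition n → Set
F ≐ G = ∀ i → Composition.lump F i ≡ Composition.lump G i

-- F viewed as a total preorder: i ≥ j iff lump of i weakly left of lump of j
toPreposet : ∀ {n} → Composition n → Preposet n
toPreposet F = record
  { rel = λ i j → lump i Data.Nat.≤ lump j
  ; refl = λ i → Data.Nat.Properties.≤-refl
  ; trans = Data.Nat.Properties.≤-trans }
  where open Composition F
        import Data.Nat.Properties

FirstLumpContains : ∀ {n} → Fin n → Composition n → Set
FirstLumpContains i0 F = Composition.lump F i0 ≡ 0

module _ {c ℓ} (K : CharZeroField c ℓ) (lem : ExcludedMiddle 0ℓ) where
  open CharZeroField K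

  combo : ∀ {n} → List (Composition n × Carrier) → (Fin n → ℚ) → Carrier
  combo L h = foldr (λ Fa acc → (proj₂ Fa * č K lem (toPreposet (proj₁ Fa)) h) + acc) 0# L

-- For generic h, the chamber of h lies in the cone σ^∨_p exactly when every
-- proper nonempty upset of p has positive h-mass (the converse direction is
-- Gale's feasibility theorem for flows), so č_p is the indicator of this
-- positivity.
--
-- Spanning: if x and y are incomparable in p, inclusion–exclusion gives
-- č_p = č_(p + x≥y) + č_(p + y≥x) − č_(p + x∼y), the one nontrivial inclusion
-- coming from submodularity of subset sums. A composition F with i0 in its
-- lump m > 0 satisfies č_F = č_M − č_q, where M merges lumps m − 1 and m, and
-- q keeps F on the first m lumps and on the others but relates the two parts
-- only by lump m ≥ lump m − 1; the two cases differ in the sign of the first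
-- m lumps. Both reductions decrease the number of elements not weakly after
-- i0, or keep it and decrease the number of unrelated pairs.
--
-- Independence: for F ∈ Σ_i0 there are generic points h_s, indexed by sign
-- vectors s, such that the signed sum of č_G(h_s) is the indicator of a
-- property of G which holds for G = F and otherwise forces lump_G ≥ lump_F
-- pointwise with G ≠ F. The resulting linear system is unitriangular.

module Submission where

open import Defs
open import Level using (0ℓ)
open import Data.Nat using (ℕ)
open import Data.Fin using (Fin)
open import Data.Rational using (ℚ)
open import Data.Product using (∃; _×_; proj₁; proj₂; _,_)
open import Data.List using (List)
open import Data.List.Relation.Unary.All using (All)
open import Data.List.Relation.Unary.AllPairs using (AllPairs)
open import Relation.Nullary using (¬_)
open import Axiom.ExcludedMiddle using (ExcludedMiddle)

module Sums where

  open import Data.Nat using (zero; suc)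
  open import Data.Fin as Fin using (Fin; zero; suc)
  import Data.Fin.Properties as FinP
  open import Data.Bool using (Bool; true; false; if_then_else_; _∧_; _∨_; not)
  import Data.Bool.Properties as BoolP
  open import Data.Product using (_×_; _,_)
  open import Data.Sum using (_⊎_; inj₁; inj₂)
  open import Data.Empty using (⊥-elim)
  open import Relation.Nullary using (Dec; yes; no)
  open import Relation.Binary.PropositionalEquality
  open import Data.Rational using (ℚ; 0ℚ; _+_; _*_; -_; _-_; _≤_)
  import Data.Rational.Properties as ℚP
  open import Data.Rational.Solver using (module +-*-Solver)
  open +-*-Solver

  sumℚ-cong : ∀ {n} {f g : Fin n → ℚ} → (∀ i → f i ≡ g i) → sumℚ f ≡ sumℚ g
  sumℚ-cong {zero}  e = refl
  sumℚ-cong {suc n} e = cong₂ _+_ (e zero) (sumℚ-cong (λ i → e (suc i)))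

  sumℚ-zero : ∀ n → sumℚ {n} (λ _ → 0ℚ) ≡ 0ℚ
  sumℚ-zero zero    = refl
  sumℚ-zero (suc n) = trans (ℚP.+-identityˡ _) (sumℚ-zero n)

  sumℚ-+ : ∀ {n} (f g : Fin n → ℚ) → sumℚ (λ i → f i + g i) ≡ sumℚ f + sumℚ g
  sumℚ-+ {zero}  f g = refl
  sumℚ-+ {suc n} f g =
    trans (cong (f zero + g zero +_) (sumℚ-+ (λ i → f (suc i)) (λ i → g (suc i))))
          (interchange (f zero) (g zero) (sumℚ (λ i → f (suc i))) (sumℚ (λ i → g (suc i))))
    where
    interchange : ∀ a b c d → (a + b) + (c + d) ≡ (a + c) + (b + d)
    interchange = solve 4 (λ a b c d → (a :+ b) :+ (c :+ d) := (a :+ c) :+ (b :+ d)) refl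

  sumℚ-neg : ∀ {n} (f : Fin n → ℚ) → sumℚ (λ i → - f i) ≡ - sumℚ f
  sumℚ-neg {zero}  f = refl
  sumℚ-neg {suc n} f = trans (cong (- f zero +_) (sumℚ-neg (λ i → f (suc i))))
                             (sym (ℚP.neg-distrib-+ (f zero) _))

  sumℚ-sub : ∀ {n} (f g : Fin n → ℚ) → sumℚ (λ i → f i - g i) ≡ sumℚ f - sumℚ g
  sumℚ-sub f g = trans (sumℚ-+ f (λ i → - g i)) (cong (sumℚ f +_) (sumℚ-neg g))

  sumℚ-* : ∀ {n} (c : ℚ) (f : Fin n → ℚ) → sumℚ (λ i → c * f i) ≡ c * sumℚ f
  sumℚ-* {zero}  c f = sym (ℚP.*-zeroʳ c)
  sumℚ-* {suc n} c f = trans (cong (c * f zero +_) (sumℚ-* c (λ i → f (suc i))))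
                             (sym (ℚP.*-distribˡ-+ c _ _))

  sumℚ-comm : ∀ {m n} (f : Fin m → Fin n → ℚ) →
    sumℚ (λ i → sumℚ (f i)) ≡ sumℚ (λ j → sumℚ (λ i → f i j))
  sumℚ-comm {zero}  {n} f = sym (sumℚ-zero n)
  sumℚ-comm {suc m} {n} f =
    trans (cong (sumℚ (f zero) +_) (sumℚ-comm (λ i → f (suc i))))
          (sym (sumℚ-+ (f zero) (λ j → sumℚ (λ i → f (suc i) j))))

  sumℚ-mono-≤ : ∀ {n} {f g : Fin n → ℚ} → (∀ i → f i ≤ g i) → sumℚ f ≤ sumℚ g
  sumℚ-mono-≤ {zero}  le = ℚP.≤-refl
  sumℚ-mono-≤ {suc n} le = ℚP.+-mono-≤ (le zero) (sumℚ-mono-≤ (λ i → le (suc i)))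

  sumℚ-nonneg : ∀ {n} {f : Fin n → ℚ} → (∀ i → 0ℚ ≤ f i) → 0ℚ ≤ sumℚ f
  sumℚ-nonneg {n} {f} le = subst (_≤ sumℚ f) (sumℚ-zero n) (sumℚ-mono-≤ le)

  δ : ∀ {n} → Fin n → ℚ → Fin n → ℚ
  δ k c i with i Fin.≟ k
  ... | yes _ = c
  ... | no  _ = 0ℚ

  δ-same : ∀ {n} (k : Fin n) c → δ k c k ≡ c
  δ-same k c with k Fin.≟ k
  ... | yes _ = refl
  ... | no k≢k = ⊥-elim (k≢k refl)

  δ-other : ∀ {n} {k i : Fin n} c → i ≢ k → δ k c i ≡ 0ℚ
  δ-other {k = k} {i} c i≢k with i Fin.≟ k
  ... | yes i≡k = ⊥-elim (i≢k i≡k)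
  ... | no  _   = refl

  sumℚ-δ : ∀ {n} (k : Fin n) (c : ℚ) → sumℚ (δ k c) ≡ c
  sumℚ-δ {suc n} zero c =
    trans (cong (c +_) (trans (sumℚ-cong {n} (λ i → δ-other {k = zero} {i = suc i} c (λ ()))) (sumℚ-zero n)))
          (ℚP.+-identityʳ c)
  sumℚ-δ {suc n} (suc k) c =
    trans (cong₂ _+_ (δ-other {k = suc k} {i = zero} c (λ ())) (trans (sumℚ-cong shift) (sumℚ-δ k c))) (ℚP.+-identityˡ c)
    where
    shift : ∀ i → δ (suc k) c (suc i) ≡ δ k c i
    shift i = by (i Fin.≟ k)
      where
      by : Dec (i ≡ k) → δ (suc k) c (suc i) ≡ δ k c i
      by (yes refl) = trans (δ-same (suc i) c) (sym (δ-same i c))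
      by (no  i≢k)  = trans (δ-other {k = suc k} c (λ e → i≢k (FinP.suc-injective e))) (sym (δ-other c i≢k))

  sumℚ≤single : ∀ {n} (f : Fin n → ℚ) (k : Fin n) → (∀ i → i ≢ k → f i ≤ 0ℚ) → sumℚ f ≤ f k
  sumℚ≤single f k rest = subst (sumℚ f ≤_) (sumℚ-δ k (f k)) (sumℚ-mono-≤ below)
    where
    below : ∀ i → f i ≤ δ k (f k) i
    below i with i Fin.≟ k
    ... | yes refl = ℚP.≤-refl
    ... | no  i≢k  = rest i i≢k

  single≤sumℚ : ∀ {n} (f : Fin n → ℚ) (k : Fin n) → (∀ i → 0ℚ ≤ f i) → f k ≤ sumℚ f
  single≤sumℚ f k nonneg = subst (_≤ sumℚ f) (sumℚ-δ k (f k)) (sumℚ-mono-≤ above)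
    where
    above : ∀ i → δ k (f k) i ≤ f i
    above i with i Fin.≟ k
    ... | yes refl = ℚP.≤-refl
    ... | no  _    = nonneg i

  infixr 7 _∩_
  infixr 6 _∪_

  _∩_ _∪_ : ∀ {n} → Subset n → Subset n → Subset n
  (V ∩ W) i = V i ∧ W i
  (V ∪ W) i = V i ∨ W i

  ∁ : ∀ {n} → Subset n → Subset n
  ∁ V i = not (V i)

  true≢false : true ≢ false
  true≢false ()

  module _ {n} (V W : Subset n) {x : Fin n} where

    ∩-intro : V x ≡ true → W x ≡ true → (V ∩ W) x ≡ true
    ∩-intro Vx Wx rewrite Vx | Wx = refl

    ∩-elim : (V ∩ W) x ≡ true → V x ≡ true × W x ≡ true
    ∩-elim e with V x | W x
    ... | true | true = refl , refl

    ∪-intro : V x ≡ true ⊎ W x ≡ true → (V ∪ W) x ≡ true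
    ∪-intro (inj₁ Vx) rewrite Vx = refl
    ∪-intro (inj₂ Wx) rewrite Wx = BoolP.∨-zeroʳ (V x)

    ∪-elim : (V ∪ W) x ≡ true → V x ≡ true ⊎ W x ≡ true
    ∪-elim e with V x | W x
    ... | true  | _    = inj₁ refl
    ... | false | true = inj₂ refl

  restrict : ∀ {n} → Subset n → (Fin n → ℚ) → Fin n → ℚ
  restrict V h i = if V i then h i else 0ℚ

  subsetSum-cong : ∀ {n} {V W : Subset n} (h : Fin n → ℚ) → (∀ i → V i ≡ W i) →
    subsetSum V h ≡ subsetSum W h
  subsetSum-cong h e = sumℚ-cong (λ i → cong (λ b → if b then h i else 0ℚ) (e i))

  subsetSum-congʳ : ∀ {n} (V : Subset n) {f g : Fin n → ℚ} → (∀ i → f i ≡ g i) →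
    subsetSum V f ≡ subsetSum V g
  subsetSum-congʳ V e = sumℚ-cong (λ i → cong (λ q → if V i then q else 0ℚ) (e i))

  subsetSum-∅ : ∀ {n} {V : Subset n} (h : Fin n → ℚ) → (∀ i → V i ≡ false) → subsetSum V h ≡ 0ℚ
  subsetSum-∅ {n} h e = trans (subsetSum-cong h e) (sumℚ-zero n)

  subsetSum-full : ∀ {n} {V : Subset n} (h : Fin n → ℚ) → (∀ i → V i ≡ true) → subsetSum V h ≡ sumℚ h
  subsetSum-full h e = subsetSum-cong h e

  subsetSum-0 : ∀ {n} (V : Subset n) → subsetSum V (λ _ → 0ℚ) ≡ 0ℚ
  subsetSum-0 {n} V = trans (sumℚ-cong zero-if) (sumℚ-zero n)
    where
    zero-if : ∀ i → restrict V (λ _ → 0ℚ) i ≡ 0ℚ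
    zero-if i with V i
    ... | true  = refl
    ... | false = refl

  subsetSum-+ : ∀ {n} (V : Subset n) (f g : Fin n → ℚ) →
    subsetSum V (λ i → f i + g i) ≡ subsetSum V f + subsetSum V g
  subsetSum-+ V f g = trans (sumℚ-cong restrict-+) (sumℚ-+ (restrict V f) (restrict V g))
    where
    restrict-+ : ∀ i → restrict V (λ i → f i + g i) i ≡ restrict V f i + restrict V g i
    restrict-+ i with V i
    ... | true  = refl
    ... | false = refl

  subsetSum-sub : ∀ {n} (V : Subset n) (f g : Fin n → ℚ) →
    subsetSum V (λ i → f i - g i) ≡ subsetSum V f - subsetSum V g
  subsetSum-sub V f g = trans (sumℚ-cong restrict-sub) (sumℚ-sub (restrict V f) (restrict V g))
    where
    restrict-sub : ∀ i → restrict V (λ i → f i - g i) i ≡ restrict V f i - restrict V g i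
    restrict-sub i with V i
    ... | true  = refl
    ... | false = refl

  subsetSum-* : ∀ {n} (V : Subset n) (c : ℚ) (f : Fin n → ℚ) →
    subsetSum V (λ i → c * f i) ≡ c * subsetSum V f
  subsetSum-* V c f = trans (sumℚ-cong restrict-*) (sumℚ-* c (restrict V f))
    where
    restrict-* : ∀ i → restrict V (λ i → c * f i) i ≡ c * restrict V f i
    restrict-* i with V i
    ... | true  = refl
    ... | false = sym (ℚP.*-zeroʳ c)

  subsetSum-δ : ∀ {n} (V : Subset n) (k : Fin n) (c : ℚ) →
    subsetSum V (δ k c) ≡ (if V k then c else 0ℚ)
  subsetSum-δ V k c = trans (sumℚ-cong restrict-δ) (sumℚ-δ k (if V k then c else 0ℚ))
    where
    restrict-δ : ∀ i → restrict V (δ k c) i ≡ δ k (if V k then c else 0ℚ) i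
    restrict-δ i with i Fin.≟ k
    ... | yes refl = refl
    ... | no  _ with V i
    ...   | true  = refl
    ...   | false = refl

  subsetSum-restrict : ∀ {n} (W V : Subset n) (h : Fin n → ℚ) →
    subsetSum W (restrict V h) ≡ subsetSum (W ∩ V) h
  subsetSum-restrict W V h = sumℚ-cong restrict-restrict
    where
    restrict-restrict : ∀ i → restrict W (restrict V h) i ≡ restrict (W ∩ V) h i
    restrict-restrict i with W i | V i
    ... | true  | true  = refl
    ... | true  | false = refl
    ... | false | _     = refl

  restrict-∁ : ∀ {n} (V : Subset n) (h : Fin n → ℚ) i → restrict V h i + restrict (∁ V) h i ≡ h i
  restrict-∁ V h i with V i
  ... | true  = ℚP.+-identityʳ (h i)
  ... | false = ℚP.+-identityˡ (h i)

  subsetSum-∁ : ∀ {n} (V : Subset n) (h : Fin n → ℚ) → subsetSum V h + subsetSum (∁ V) h ≡ sumℚ h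
  subsetSum-∁ V h = trans (sym (sumℚ-+ (restrict V h) (restrict (∁ V) h))) (sumℚ-cong (restrict-∁ V h))

  subsetSum-∩∪ : ∀ {n} (V W : Subset n) (h : Fin n → ℚ) →
    subsetSum V h + subsetSum W h ≡ subsetSum (V ∩ W) h + subsetSum (V ∪ W) h
  subsetSum-∩∪ V W h =
    trans (sym (sumℚ-+ (restrict V h) (restrict W h)))
          (trans (sumℚ-cong modular) (sumℚ-+ (restrict (V ∩ W) h) (restrict (V ∪ W) h)))
    where
    modular : ∀ i → restrict V h i + restrict W h i ≡ restrict (V ∩ W) h i + restrict (V ∪ W) h i
    modular i with V i | W i
    ... | true  | true  = refl
    ... | true  | false = ℚP.+-comm (h i) 0ℚ
    ... | false | true  = refl
    ... | false | false = refl

  subsetSum-∩∁ : ∀ {n} (V U : Subset n) (h : Fin n → ℚ) →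
    subsetSum (V ∩ U) h + subsetSum (V ∩ ∁ U) h ≡ subsetSum V h
  subsetSum-∩∁ V U h =
    trans (subsetSum-∩∪ (V ∩ U) (V ∩ ∁ U) h)
          (trans (cong₂ _+_ (subsetSum-∅ h disjoint) (subsetSum-cong h covers)) (ℚP.+-identityˡ _))
    where
    disjoint : ∀ i → ((V ∩ U) ∩ (V ∩ ∁ U)) i ≡ false
    disjoint i with V i | U i
    ... | true  | true  = refl
    ... | true  | false = refl
    ... | false | _     = refl
    covers : ∀ i → ((V ∩ U) ∪ (V ∩ ∁ U)) i ≡ V i
    covers i with V i | U i
    ... | true  | true  = refl
    ... | true  | false = refl
    ... | false | _     = refl

  subsetSum-∖∪ : ∀ {n} (U V : Subset n) (h : Fin n → ℚ) →
    subsetSum (U ∩ ∁ V) h + subsetSum V h ≡ subsetSum (U ∪ V) h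
  subsetSum-∖∪ U V h = trans (sym (sumℚ-+ (restrict (U ∩ ∁ V) h) (restrict V h))) (sumℚ-cong pointwise)
    where
    pointwise : ∀ i → restrict (U ∩ ∁ V) h i + restrict V h i ≡ restrict (U ∪ V) h i
    pointwise i with U i | V i
    ... | true  | true  = ℚP.+-identityˡ (h i)
    ... | true  | false = ℚP.+-identityʳ (h i)
    ... | false | true  = ℚP.+-identityˡ (h i)
    ... | false | false = refl

module Counting where

  open import Data.Nat as ℕ using (ℕ; zero; suc; _≤_; _<_; _+_; z≤n; s≤s)
  import Data.Nat.Properties as ℕP
  open import Data.Fin as Fin using (Fin; zero; suc)
  import Data.Fin.Properties as FinP
  open import Data.Bool using (Bool; true; false; if_then_else_; _∨_)
  import Data.Bool.Properties as BoolP
  open import Data.Product using (∃; _×_; _,_)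
  open import Data.Sum using (_⊎_; inj₁; inj₂)
  open import Data.Empty using (⊥-elim)
  open import Relation.Nullary using (yes; no; does)
  open import Relation.Binary.PropositionalEquality

  count : ∀ {n} → (Fin n → Bool) → ℕ
  count {zero}  f = 0
  count {suc n} f = (if f zero then 1 else 0) + count (λ i → f (suc i))

  count-cong : ∀ {n} {f g : Fin n → Bool} → (∀ k → f k ≡ g k) → count f ≡ count g
  count-cong {zero}  e = refl
  count-cong {suc n} e = cong₂ _+_ (cong (λ b → if b then 1 else 0) (e zero)) (count-cong (λ i → e (suc i)))

  count-mono : ∀ {n} {f g : Fin n → Bool} → (∀ k → f k ≡ true → g k ≡ true) → count f ≤ count g
  count-mono {zero}  f⊆g = z≤n
  count-mono {suc n} {f} {g} f⊆g with f zero in f0 | g zero in g0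
  ... | true  | true  = s≤s (count-mono (λ k → f⊆g (suc k)))
  ... | false | true  = ℕP.m≤n⇒m≤1+n (count-mono (λ k → f⊆g (suc k)))
  ... | false | false = count-mono (λ k → f⊆g (suc k))
  ... | true  | false with () ← trans (sym g0) (f⊆g zero f0)

  count-strict : ∀ {n} {f g : Fin n → Bool} → (∀ k → f k ≡ true → g k ≡ true) →
    ∀ j → f j ≡ false → g j ≡ true → count f < count g
  count-strict {suc n} {f} {g} f⊆g zero fj gj rewrite fj | gj = s≤s (count-mono (λ k → f⊆g (suc k)))
  count-strict {suc n} {f} {g} f⊆g (suc j) fj gj with f zero in f0 | g zero in g0
  ... | true  | true  = s≤s (count-strict (λ k → f⊆g (suc k)) j fj gj)
  ... | false | true  = ℕP.m≤n⇒m≤1+n (count-strict (λ k → f⊆g (suc k)) j fj gj)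
  ... | false | false = count-strict (λ k → f⊆g (suc k)) j fj gj
  ... | true  | false with () ← trans (sym g0) (f⊆g zero f0)

  count-pos : ∀ {n} (f : Fin n → Bool) → 0 < count f → ∃ λ k → f k ≡ true
  count-pos {suc n} f pos with f zero in f0
  ... | true  = zero , f0
  ... | false with count-pos (λ i → f (suc i)) pos
  ...   | k , fk = suc k , fk

  count-insert : ∀ {n} (f : Fin n → Bool) (j : Fin n) → f j ≡ false →
    count (λ k → f k ∨ does (k Fin.≟ j)) ≡ suc (count f)
  count-insert {suc n} f zero fj rewrite fj = cong suc (count-cong (λ k → BoolP.∨-identityʳ (f (suc k))))
  count-insert {suc n} f (suc j) fj =
    trans (cong₂ _+_ (cong (λ b → if b then 1 else 0) (BoolP.∨-identityʳ (f zero)))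
                     (trans (count-cong (λ k → cong (f (suc k) ∨_) (suc≟suc k))) (count-insert (λ i → f (suc i)) j fj)))
          (ℕP.+-suc _ _)
    where
    suc≟suc : ∀ k → does (suc k Fin.≟ suc j) ≡ does (k Fin.≟ j)
    suc≟suc k with k Fin.≟ j
    ... | yes _ = refl
    ... | no  _ = refl

  sumℕ : ∀ {n} → (Fin n → ℕ) → ℕ
  sumℕ {zero}  g = 0
  sumℕ {suc n} g = g zero + sumℕ (λ i → g (suc i))

  sumℕ-mono : ∀ {n} {g g′ : Fin n → ℕ} → (∀ a → g a ≤ g′ a) → sumℕ g ≤ sumℕ g′
  sumℕ-mono {zero}  le = z≤n
  sumℕ-mono {suc n} le = ℕP.+-mono-≤ (le zero) (sumℕ-mono (λ a → le (suc a)))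

  sumℕ-strict : ∀ {n} {g g′ : Fin n → ℕ} → (∀ a → g a ≤ g′ a) → ∀ b → g b < g′ b → sumℕ g < sumℕ g′
  sumℕ-strict {suc n} le zero    lt = ℕP.+-mono-<-≤ lt (sumℕ-mono (λ a → le (suc a)))
  sumℕ-strict {suc n} le (suc b) lt = ℕP.+-mono-≤-< (le zero) (sumℕ-strict (λ a → le (suc a)) b lt)

  module _ {R : ℕ → ℕ → Set} (R-refl : ∀ {a} → R a a) (R-trans : ∀ {a b c} → R a b → R b c → R a c)
           (R-total : ∀ a b → R a b ⊎ R b a) where

    optimum : ∀ {n} (P : Fin n → Bool) (f : Fin n → ℕ) → ∃ (λ z → P z ≡ true) →
      ∃ λ j → P j ≡ true × (∀ z → P z ≡ true → R (f j) (f z))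
    optimum {suc n} P f (z₀ , Pz₀) with FinP.any? (λ i → P (suc i) Data.Bool.≟ true)
    ... | no none = zero , at-zero z₀ Pz₀ , best
      where
      at-zero : ∀ z → P z ≡ true → P zero ≡ true
      at-zero zero    Pz = Pz
      at-zero (suc i) Pz = ⊥-elim (none (i , Pz))
      best : ∀ z → P z ≡ true → R (f zero) (f z)
      best zero    _  = R-refl
      best (suc i) Pz = ⊥-elim (none (i , Pz))
    ... | yes some with optimum (λ i → P (suc i)) (λ i → f (suc i)) some
    ...   | j , Pj , best with P zero in P0 | R-total (f zero) (f (suc j))
    ...     | true  | inj₁ f0≼ = zero , P0 , λ { zero _ → R-refl ; (suc i) Pi → R-trans f0≼ (best i Pi) }
    ...     | true  | inj₂ ≼f0 = suc j , Pj , λ { zero _ → ≼f0 ; (suc i) Pi → best i Pi }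
    ...     | false | _        = suc j , Pj , best′
      where
      best′ : ∀ z → P z ≡ true → R (f (suc j)) (f z)
      best′ zero    Pz with () ← trans (sym P0) Pz
      best′ (suc i) Pi = best i Pi

  argmin : ∀ {n} (P : Fin n → Bool) (f : Fin n → ℕ) → ∃ (λ z → P z ≡ true) →
    ∃ λ j → P j ≡ true × (∀ z → P z ≡ true → f j ≤ f z)
  argmin = optimum ℕP.≤-refl ℕP.≤-trans ℕP.≤-total

  argmax : ∀ {n} (P : Fin n → Bool) (f : Fin n → ℕ) → ∃ (λ z → P z ≡ true) →
    ∃ λ j → P j ≡ true × (∀ z → P z ≡ true → f z ≤ f j)
  argmax = optimum ℕP.≤-refl (λ j≥k k≥l → ℕP.≤-trans k≥l j≥k) (λ a b → ℕP.≤-total b a)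

module Classical where

  open import Level using (0ℓ)
  open import Axiom.ExcludedMiddle using (ExcludedMiddle)
  open import Data.Bool using (Bool; true; false)
  open import Relation.Nullary using (¬_; Dec; yes; no; does)
  open import Relation.Nullary.Decidable using (dec-true; dec-false; does-⇔)
  open import Function.Bundles using (mk⇔)
  open import Relation.Binary.PropositionalEquality using (_≡_)

  from-does : ∀ {P : Set} (d : Dec P) → does d ≡ true → P
  from-does (yes p) _ = p

  from-does¬ : ∀ {P : Set} (d : Dec P) → does d ≡ false → ¬ P
  from-does¬ (no ¬p) _ = ¬p

  module _ (lem : ExcludedMiddle 0ℓ) where

    holds : Set → Bool
    holds P = does (lem {P})

    holds-intro : ∀ {P} → P → holds P ≡ true
    holds-intro {P} = dec-true (lem {P})

    holds-intro¬ : ∀ {P} → ¬ P → holds P ≡ false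
    holds-intro¬ {P} = dec-false (lem {P})

    holds-elim : ∀ {P} → holds P ≡ true → P
    holds-elim {P} = from-does (lem {P})

    holds-cong : ∀ {P Q} → (P → Q) → (Q → P) → holds P ≡ holds Q
    holds-cong {P} {Q} to from = does-⇔ (mk⇔ to from) (lem {P}) (lem {Q})

module Cones where

  open Sums
  open Counting
  open Classical
  open import Level using (0ℓ)
  open import Axiom.ExcludedMiddle using (ExcludedMiddle)
  open import Data.Nat as ℕ using (ℕ)
  open import Data.Nat.Induction using (<-wellFounded)
  open import Induction.WellFounded using (Acc; acc)
  open import Data.Fin as Fin using (Fin)
  import Data.Fin.Properties as FinP
  open import Data.Bool using (Bool; true; false; if_then_else_; _∧_; _∨_; not)
  import Data.Bool.Properties as BoolP
  open import Data.Product using (∃; _×_; _,_; proj₁; proj₂)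
  open import Data.Sum using (_⊎_; inj₁; inj₂)
  open import Data.Empty using (⊥; ⊥-elim)
  open import Relation.Nullary using (¬_; Dec; yes; no; does)
  open import Relation.Nullary.Decidable using (dec-true; dec-false)
  open import Relation.Binary.PropositionalEquality
  open import Relation.Binary.Definitions using (tri<; tri≈; tri>)
  open import Data.Rational using (ℚ; 0ℚ; _+_; _*_; -_; _-_; _≤_; _<_; _⊓_)
  open import Data.Rational.Properties as ℚP using (_≟_; _<?_)
  open import Data.Rational.Solver using (module +-*-Solver)
  open +-*-Solver

  ≤∧≢⇒< : ∀ {p q : ℚ} → p ≤ q → p ≢ q → p < q
  ≤∧≢⇒< {p} {q} p≤q p≢q with ℚP.<-cmp p q
  ... | tri< p<q _ _ = p<q
  ... | tri≈ _ p≡q _ = ⊥-elim (p≢q p≡q)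
  ... | tri> _ _ p>q = ⊥-elim (ℚP.<-irrefl refl (ℚP.≤-<-trans p≤q p>q))

  ≮∧≢⇒> : ∀ {p q : ℚ} → ¬ p < q → p ≢ q → q < p
  ≮∧≢⇒> p≮q p≢q = ≤∧≢⇒< (ℚP.≮⇒≥ p≮q) (λ e → p≢q (sym e))

  q≤p⇒0≤p-q : ∀ {p q : ℚ} → q ≤ p → 0ℚ ≤ p - q
  q≤p⇒0≤p-q {p} {q} q≤p = subst (_≤ p - q) (ℚP.+-inverseʳ q) (ℚP.+-monoˡ-≤ (- q) q≤p)

  pos+nonneg : ∀ {a b : ℚ} → 0ℚ < a → 0ℚ ≤ b → 0ℚ < a + b
  pos+nonneg {a} {b} 0<a 0≤b = subst (_< a + b) (ℚP.+-identityʳ 0ℚ) (ℚP.+-mono-<-≤ 0<a 0≤b)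

  nonneg+pos : ∀ {a b : ℚ} → 0ℚ ≤ a → 0ℚ < b → 0ℚ < a + b
  nonneg+pos {a} {b} 0≤a 0<b = subst (_< a + b) (ℚP.+-identityʳ 0ℚ) (ℚP.+-mono-≤-< 0≤a 0<b)

  sum≡0∧neg⇒pos : ∀ {a b : ℚ} → a + b ≡ 0ℚ → a < 0ℚ → 0ℚ < b
  sum≡0∧neg⇒pos {a} {b} a+b≡0 a<0 = subst₂ _<_ a+b≡0 (ℚP.+-identityˡ b) (ℚP.+-monoˡ-< b a<0)

  minus-plus : ∀ a t → a - t + t ≡ a
  minus-plus = solve 2 (λ a t → a :- t :+ t := a) refl

  IsUpset : ∀ {n} → Preposet n → Subset n → Set
  IsUpset p U = ∀ x y → U x ≡ true → Preposet.rel p y x → U y ≡ true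

  UpsetsNonneg : ∀ {n} → Preposet n → (Fin n → ℚ) → Set
  UpsetsNonneg p h = ∀ U → IsUpset p U → 0ℚ ≤ subsetSum U h

  Positive : ∀ {n} → Preposet n → (Fin n → ℚ) → Set
  Positive p h = ∀ U → ProperNonempty U → IsUpset p U → 0ℚ < subsetSum U h

  upset-mono : ∀ {n} {p q : Preposet n} → (∀ x y → Preposet.rel q x y → Preposet.rel p x y) →
    ∀ {V} → IsUpset p V → IsUpset q V
  upset-mono q⊆p V↑ x y Vx y≥x = V↑ x y Vx (q⊆p y x y≥x)

  positive-mono : ∀ {n} {p q : Preposet n} → (∀ x y → Preposet.rel q x y → Preposet.rel p x y) →
    ∀ {h} → Positive q h → Positive p h
  positive-mono {p = p} {q} q⊆p pos V proper V↑ = pos V proper (upset-mono {p = p} {q} q⊆p V↑)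

  module _ {n} {p : Preposet n} where

    upset-∩ : ∀ {V W : Subset n} → IsUpset p V → IsUpset p W → IsUpset p (V ∩ W)
    upset-∩ {V} {W} V↑ W↑ x y x∈ y≥x =
      let (Vx , Wx) = ∩-elim V W x∈ in ∩-intro V W (V↑ x y Vx y≥x) (W↑ x y Wx y≥x)

    upset-∪ : ∀ {V W : Subset n} → IsUpset p V → IsUpset p W → IsUpset p (V ∪ W)
    upset-∪ {V} {W} V↑ W↑ x y x∈ y≥x with ∪-elim V W x∈
    ... | inj₁ Vx = ∪-intro V W (inj₁ (V↑ x y Vx y≥x))
    ... | inj₂ Wx = ∪-intro V W (inj₂ (W↑ x y Wx y≥x))

    inCone⇒upset-nonneg : ∀ {h U} → InCone p h → IsUpset p U → 0ℚ ≤ subsetSum U h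
    inCone⇒upset-nonneg {h} {U} (w , w≥0 , w-supp , h≡) U↑ =
      subst (0ℚ ≤_) (sym flow) (sumℚ-nonneg λ a → sumℚ-nonneg λ b → net a b)
      where
      out into : Fin n → Fin n → ℚ
      out  a b = if U a then w a b else 0ℚ
      into a b = if U b then w a b else 0ℚ

      restrict-flow : ∀ k → restrict U h k ≡ sumℚ (out k) - sumℚ (λ i → into i k)
      restrict-flow k with U k
      ... | true  = h≡ k
      ... | false = sym (cong₂ _-_ (sumℚ-zero n) (sumℚ-zero n))

      flow : subsetSum U h ≡ sumℚ (λ a → sumℚ (λ b → out a b - into a b))
      flow = begin
        subsetSum U h
          ≡⟨ sumℚ-cong restrict-flow ⟩
        sumℚ (λ k → sumℚ (out k) - sumℚ (λ i → into i k))
          ≡⟨ sumℚ-sub (λ k → sumℚ (out k)) (λ k → sumℚ (λ i → into i k)) ⟩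
        sumℚ (λ a → sumℚ (out a)) - sumℚ (λ k → sumℚ (λ i → into i k))
          ≡⟨ cong (λ z → sumℚ (λ a → sumℚ (out a)) - z) (sumℚ-comm (λ k i → into i k)) ⟩
        sumℚ (λ a → sumℚ (out a)) - sumℚ (λ a → sumℚ (into a))
          ≡⟨ sym (sumℚ-sub (λ a → sumℚ (out a)) (λ a → sumℚ (into a))) ⟩
        sumℚ (λ a → sumℚ (out a) - sumℚ (into a))
          ≡⟨ sumℚ-cong (λ a → sym (sumℚ-sub (out a) (into a))) ⟩
        sumℚ (λ a → sumℚ (λ b → out a b - into a b))
          ∎
        where open ≡-Reasoning

      -- an edge a ≥ b leaving U would contradict U being an upset
      net : ∀ a b → 0ℚ ≤ out a b - into a b
      net a b with U a in Ua | U b in Ub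
      ... | true  | true  = q≤p⇒0≤p-q (ℚP.≤-refl {w a b})
      ... | true  | false = subst (0ℚ ≤_) (sym (ℚP.+-identityʳ (w a b))) (w≥0 a b)
      ... | false | false = ℚP.≤-refl
      ... | false | true  = ℚP.≤-reflexive (sym (cong (λ z → 0ℚ - z) (w-supp a b (inj₁ leaves))))
        where
        leaves : ¬ Preposet.rel p a b
        leaves r with () ← trans (sym (U↑ b a Ub r)) Ua

  consSubset : ∀ {m} → Bool → Subset m → Subset (ℕ.suc m)
  consSubset b V Fin.zero    = b
  consSubset b V (Fin.suc i) = V i

  minOver : ∀ {m} → (Subset m → ℚ) → ℚ
  minOver {ℕ.zero}  G = G (λ ())
  minOver {ℕ.suc m} G = minOver (λ V → G (consSubset true V)) ⊓ minOver (λ V → G (consSubset false V))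

  RespectsExt : ∀ {m} → (Subset m → ℚ) → Set
  RespectsExt G = ∀ V W → (∀ i → V i ≡ W i) → G V ≡ G W

  minOver-≤ : ∀ {m} (G : Subset m → ℚ) → RespectsExt G → ∀ V → minOver G ≤ G V
  minOver-≤ {ℕ.zero}  G G-ext V = ℚP.≤-reflexive (G-ext _ _ (λ ()))
  minOver-≤ {ℕ.suc m} G G-ext V =
    ℚP.≤-trans (minOver≤branch (V Fin.zero))
      (ℚP.≤-trans (minOver-≤ _ (tail-ext (V Fin.zero)) (λ i → V (Fin.suc i)))
                  (ℚP.≤-reflexive (G-ext _ _ cons-tail)))
    where
    minOver≤branch : ∀ b → minOver G ≤ minOver (λ W → G (consSubset b W))
    minOver≤branch true  = ℚP.p⊓q≤p _ _
    minOver≤branch false = ℚP.p⊓q≤q (minOver (λ W → G (consSubset true W))) _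
    tail-ext : ∀ b → RespectsExt (λ W → G (consSubset b W))
    tail-ext b W W′ e = G-ext _ _ λ { Fin.zero → refl ; (Fin.suc i) → e i }
    cons-tail : ∀ i → consSubset (V Fin.zero) (λ i → V (Fin.suc i)) i ≡ V i
    cons-tail Fin.zero    = refl
    cons-tail (Fin.suc i) = refl

  minOver-attained : ∀ {m} (G : Subset m → ℚ) → ∃ λ V → minOver G ≡ G V
  minOver-attained {ℕ.zero}  G = (λ ()) , refl
  minOver-attained {ℕ.suc m} G
    with ℚP.⊓-sel (minOver (λ V → G (consSubset true V))) (minOver (λ V → G (consSubset false V)))
  ... | inj₁ e = let (V , eV) = minOver-attained (λ V → G (consSubset true V))  in consSubset true V  , trans e eV
  ... | inj₂ e = let (V , eV) = minOver-attained (λ V → G (consSubset false V)) in consSubset false V , trans e eV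

  nonzero? : ℚ → Bool
  nonzero? q = not (does (q ≟ 0ℚ))

  nonzero?-true : ∀ {q} → q ≢ 0ℚ → nonzero? q ≡ true
  nonzero?-true {q} q≢0 = cong not (dec-false (q ≟ 0ℚ) q≢0)

  nonzero?-false : ∀ {q} → q ≡ 0ℚ → nonzero? q ≡ false
  nonzero?-false {q} q≡0 = cong not (dec-true (q ≟ 0ℚ) q≡0)

  nonzero?-true⁻ : ∀ {q} → nonzero? q ≡ true → q ≢ 0ℚ
  nonzero?-true⁻ {q} e q≡0 with () ← trans (sym e) (nonzero?-false q≡0)

  support : ∀ {n} → (Fin n → ℚ) → ℕ
  support h = count (λ k → nonzero? (h k))

  support-< : ∀ {n} {g h : Fin n → ℚ} → (∀ k → g k ≢ 0ℚ → h k ≢ 0ℚ) →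
    ∀ j → g j ≡ 0ℚ → h j ≢ 0ℚ → support g ℕ.< support h
  support-< g⊆h j gj hj =
    count-strict (λ k e → nonzero?-true (g⊆h k (nonzero?-true⁻ e))) j (nonzero?-false gj) (nonzero?-true hj)

  module Gale {n} (lem : ExcludedMiddle 0ℓ) (p : Preposet n) where
    open Preposet p using (rel) renaming (refl to rel-refl; trans to rel-trans)

    cone-cong : ∀ {h g : Fin n → ℚ} → (∀ k → h k ≡ g k) → InCone p g → InCone p h
    cone-cong e (w , w≥0 , w-supp , g≡) = w , w≥0 , w-supp , (λ k → trans (e k) (g≡ k))

    cone-zero : ∀ {h : Fin n → ℚ} → (∀ k → h k ≡ 0ℚ) → InCone p h
    cone-zero z = (λ _ _ → 0ℚ) , (λ _ _ → ℚP.≤-refl) , (λ _ _ _ → refl) ,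
                  (λ k → trans (z k) (sym (cong₂ _-_ (sumℚ-zero n) (sumℚ-zero n))))

    cone-+ : ∀ {f g : Fin n → ℚ} → InCone p f → InCone p g → InCone p (λ k → f k + g k)
    cone-+ {f} {g} (w , w≥0 , w-supp , f≡) (v , v≥0 , v-supp , g≡) =
      (λ a b → w a b + v a b) ,
      (λ a b → subst (_≤ w a b + v a b) (ℚP.+-identityʳ 0ℚ) (ℚP.+-mono-≤ (w≥0 a b) (v≥0 a b))) ,
      (λ a b c → cong₂ _+_ (w-supp a b c) (v-supp a b c)) ,
      (λ k → begin
        f k + g k
          ≡⟨ cong₂ _+_ (f≡ k) (g≡ k) ⟩
        (sumℚ (w k) - sumℚ (λ i → w i k)) + (sumℚ (v k) - sumℚ (λ i → v i k))
          ≡⟨ regroup (sumℚ (w k)) (sumℚ (λ i → w i k)) (sumℚ (v k)) (sumℚ (λ i → v i k)) ⟩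
        (sumℚ (w k) + sumℚ (v k)) - (sumℚ (λ i → w i k) + sumℚ (λ i → v i k))
          ≡⟨ sym (cong₂ _-_ (sumℚ-+ (w k) (v k)) (sumℚ-+ (λ i → w i k) (λ i → v i k))) ⟩
        sumℚ (λ j → w k j + v k j) - sumℚ (λ i → w i k + v i k)
          ∎)
      where
      open ≡-Reasoning
      regroup : ∀ a b c d → (a - b) + (c - d) ≡ (a + c) - (b + d)
      regroup = solve 4 (λ a b c d → (a :- b) :+ (c :- d) := (a :+ c) :- (b :+ d)) refl

    cone-edge : ∀ {i j t} → rel i j → i ≢ j → 0ℚ ≤ t → InCone p (λ k → δ i t k - δ j t k)
    cone-edge {i} {j} {t} i≥j i≢j t≥0 =
      (λ a b → δ i (δ j t b) a) , (λ a b → δ-nonneg i a (δ-nonneg j b t≥0)) , off-edge ,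
      (λ k → cong₂ _-_ (sym (trans (sumℚ-δ-inner k) (cong (λ z → δ i z k) (sumℚ-δ j t))))
                       (sym (sumℚ-δ i (δ j t k))))
      where
      δ-nonneg : ∀ m l {c} → 0ℚ ≤ c → 0ℚ ≤ δ m c l
      δ-nonneg m l c≥0 with l Fin.≟ m
      ... | yes _ = c≥0
      ... | no  _ = ℚP.≤-refl
      sumℚ-δ-inner : ∀ k → sumℚ (λ b → δ i (δ j t b) k) ≡ δ i (sumℚ (δ j t)) k
      sumℚ-δ-inner k with k Fin.≟ i
      ... | yes _ = refl
      ... | no  _ = sumℚ-zero n
      off-edge : ∀ a b → (¬ rel a b ⊎ a ≡ b) → δ i (δ j t b) a ≡ 0ℚ
      off-edge a b c with a Fin.≟ i | b Fin.≟ j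
      ... | no _     | _        = refl
      ... | yes _    | no _     = refl
      off-edge a b (inj₁ ¬a≥b) | yes refl | yes refl = ⊥-elim (¬a≥b i≥j)
      off-edge a b (inj₂ a≡b)  | yes refl | yes refl = ⊥-elim (i≢j a≡b)

    shift : (Fin n → ℚ) → Fin n → Fin n → ℚ → Fin n → ℚ
    shift h i j t k = h k - δ i t k + δ j t k

    subsetSum-shift : ∀ W h i j t →
      subsetSum W (shift h i j t) ≡ subsetSum W h - (if W i then t else 0ℚ) + (if W j then t else 0ℚ)
    subsetSum-shift W h i j t =
      trans (subsetSum-+ W (λ k → h k - δ i t k) (δ j t))
            (cong₂ _+_ (trans (subsetSum-sub W h (δ i t)) (cong (λ z → subsetSum W h - z) (subsetSum-δ W i t)))
                       (subsetSum-δ W j t))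

    sumℚ-shift : ∀ h i j t → sumℚ (shift h i j t) ≡ sumℚ h
    sumℚ-shift h i j t = trans (subsetSum-shift (λ _ → true) h i j t) (minus-plus (sumℚ h) t)

    shift-other : ∀ h {i j} t {k} → k ≢ i → k ≢ j → shift h i j t k ≡ h k
    shift-other h t k≢i k≢j =
      trans (cong₂ (λ a b → h _ - a + b) (δ-other t k≢i) (δ-other t k≢j))
            (trans (ℚP.+-identityʳ _) (ℚP.+-identityʳ _))

    shift-nonneg : ∀ h i j t → 0ℚ ≤ t → UpsetsNonneg p h →
      (∀ W → IsUpset p W → W i ≡ true → W j ≡ false → t ≤ subsetSum W h) →
      UpsetsNonneg p (shift h i j t)
    shift-nonneg h i j t t≥0 nonneg cuts U U↑ rewrite subsetSum-shift U h i j t with U i in Ui | U j in Uj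
    ... | true  | true  = subst (0ℚ ≤_) (sym (minus-plus (subsetSum U h) t)) (nonneg U U↑)
    ... | true  | false = subst (0ℚ ≤_) (sym (ℚP.+-identityʳ _)) (q≤p⇒0≤p-q (cuts U U↑ Ui Uj))
    ... | false | false = subst (0ℚ ≤_) (sym (trans (ℚP.+-identityʳ _) (ℚP.+-identityʳ _))) (nonneg U U↑)
    ... | false | true  = subst (λ z → 0ℚ ≤ z + t) (sym (ℚP.+-identityʳ (subsetSum U h)))
                            (subst (_≤ subsetSum U h + t) (ℚP.+-identityʳ 0ℚ) (ℚP.+-mono-≤ (nonneg U U↑) t≥0))

    module Reduction (h : Fin n → ℚ) (sum0 : sumℚ h ≡ 0ℚ) (nonneg : UpsetsNonneg p h)
      (IH : ∀ g → support g ℕ.< support h → sumℚ g ≡ 0ℚ → UpsetsNonneg p g → InCone p g) where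

      sink : ∀ {k} → h k ≢ 0ℚ → ∃ λ j → h j < 0ℚ
      sink {k} hk≢0 with FinP.any? (λ j → h j <? 0ℚ)
      ... | yes found = found
      ... | no  none  = ⊥-elim (ℚP.<-irrefl refl
                          (ℚP.<-≤-trans 0<hk (ℚP.≤-trans (single≤sumℚ h k h≥0) (ℚP.≤-reflexive sum0))))
        where
        h≥0 : ∀ i → 0ℚ ≤ h i
        h≥0 i = ℚP.≮⇒≥ (λ neg → none (i , neg))
        0<hk : 0ℚ < h k
        0<hk = ≤∧≢⇒< (h≥0 k) (λ e → hk≢0 (sym e))

      -- otherwise the upset generated by j would have negative mass
      source : ∀ {j} → h j < 0ℚ → ∃ λ i → rel i j × i ≢ j × 0ℚ < h i
      source {j} hj<0 with lem {∃ λ i → rel i j × i ≢ j × 0ℚ < h i}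
      ... | yes found = found
      ... | no  none  = ⊥-elim (ℚP.<-irrefl refl
                          (ℚP.≤-<-trans (nonneg ↑j ↑j-upset) (ℚP.≤-<-trans (sumℚ≤single (restrict ↑j h) j others) at-j)))
        where
        ↑j : Subset n
        ↑j y = holds lem (rel y j)
        ↑j-upset : IsUpset p ↑j
        ↑j-upset x y x∈ y≥x = holds-intro lem (rel-trans y≥x (holds-elim lem x∈))
        others : ∀ k → k ≢ j → restrict ↑j h k ≤ 0ℚ
        others k k≢j with lem {rel k j}
        ... | yes k≥j = ℚP.≮⇒≥ (λ pos → none (k , k≥j , k≢j , pos))
        ... | no  _   = ℚP.≤-refl
        at-j : restrict ↑j h j < 0ℚ
        at-j with lem {rel j j}
        ... | yes _    = hj<0
        ... | no ¬j≥j = ⊥-elim (¬j≥j (rel-refl j))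

      -- Move as much mass as possible from i to j: either a coordinate
      -- vanishes, or some upset separating i from j becomes tight and h
      -- splits along it.
      module Transfer {i j} (i≥j : rel i j) (i≢j : i ≢ j) (0<hi : 0ℚ < h i) (hj<0 : h j < 0ℚ) where

        bound : ℚ
        bound = h i ⊓ (- h j)

        0<bound : 0ℚ < bound
        0<bound with ℚP.⊓-sel (h i) (- h j)
        ... | inj₁ e = subst (0ℚ <_) (sym e) 0<hi
        ... | inj₂ e = subst (0ℚ <_) (sym e) (ℚP.neg-antimono-< hj<0)

        Cut : Subset n → Set
        Cut W = IsUpset p W × W i ≡ true × W j ≡ false

        cutMass : Subset n → ℚ
        cutMass W = if holds lem (Cut W) then subsetSum W h else bound

        cutMass-ext : RespectsExt cutMass
        cutMass-ext V W V≗W =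
          cong₂ (λ b s → if b then s else bound) (holds-cong lem (transport V≗W) (transport (λ x → sym (V≗W x))))
                (subsetSum-cong h V≗W)
          where
          transport : ∀ {V W} → (∀ x → V x ≡ W x) → Cut V → Cut W
          transport V≗W (V↑ , Vi , Vj) =
            (λ x y Wx r → trans (sym (V≗W y)) (V↑ x y (trans (V≗W x) Wx) r)) ,
            trans (sym (V≗W i)) Vi , trans (sym (V≗W j)) Vj

        t : ℚ
        t = minOver cutMass

        t≤cut : ∀ W → Cut W → t ≤ subsetSum W h
        t≤cut W cut = ℚP.≤-trans (minOver-≤ cutMass cutMass-ext W)
                                 (ℚP.≤-reflexive (cong (λ b → if b then subsetSum W h else bound) (holds-intro lem cut)))

        0≤t : 0ℚ ≤ t
        0≤t with minOver-attained cutMass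
        ... | V , t≡ with lem {Cut V}
        ...   | yes (V↑ , _) = subst (0ℚ ≤_) (sym t≡) (nonneg V V↑)
        ...   | no  _        = subst (0ℚ ≤_) (sym t≡) (ℚP.<⇒≤ 0<bound)

        h′ : Fin n → ℚ
        h′ = shift h i j t

        h≡h′+edge : ∀ k → h k ≡ (h′ k) + (δ i t k - δ j t k)
        h≡h′+edge k = regroup (h k) (δ i t k) (δ j t k)
          where
          regroup : ∀ a b c → a ≡ (a - b + c) + (b - c)
          regroup = solve 3 (λ a b c → a := (a :- b :+ c) :+ (b :- c)) refl

        edge : InCone p (λ k → δ i t k - δ j t k)
        edge = cone-edge i≥j i≢j 0≤t

        h′-sum : sumℚ h′ ≡ 0ℚ
        h′-sum = trans (sumℚ-shift h i j t) sum0

        h′-nonneg : UpsetsNonneg p h′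
        h′-nonneg = shift-nonneg h i j t 0≤t nonneg (λ W W↑ Wi Wj → t≤cut W (W↑ , Wi , Wj))

        h′⊆h : ∀ k → h′ k ≢ 0ℚ → h k ≢ 0ℚ
        h′⊆h k h′k≢0 = by (k Fin.≟ i) (k Fin.≟ j)
          where
          by : Dec (k ≡ i) → Dec (k ≡ j) → h k ≢ 0ℚ
          by (yes refl) _          = λ e → ℚP.<-irrefl (sym e) 0<hi
          by (no  _)    (yes refl) = λ e → ℚP.<-irrefl e hj<0
          by (no  k≢i)  (no  k≢j)  = subst (_≢ 0ℚ) (shift-other h t k≢i k≢j) h′k≢0

        inCone-bound : t ≡ bound → InCone p h
        inCone-bound t≡bound = cone-cong h≡h′+edge (cone-+ (IH h′ smaller h′-sum h′-nonneg) edge)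
          where
          smaller : support h′ ℕ.< support h
          smaller with ℚP.⊓-sel (h i) (- h j)
          ... | inj₁ e = support-< h′⊆h i h′i≡0 (λ e′ → ℚP.<-irrefl (sym e′) 0<hi)
            where
            h′i≡0 : h′ i ≡ 0ℚ
            h′i≡0 = begin
              h i - δ i t i + δ j t i ≡⟨ cong₂ (λ a b → h i - a + b) (δ-same i t) (δ-other t i≢j) ⟩
              h i - t + 0ℚ           ≡⟨ cong (λ s → h i - s + 0ℚ) (trans t≡bound e) ⟩
              h i - h i + 0ℚ         ≡⟨ trans (ℚP.+-identityʳ _) (ℚP.+-inverseʳ (h i)) ⟩
              0ℚ                     ∎
              where open ≡-Reasoning
          ... | inj₂ e = support-< h′⊆h j h′j≡0 (λ e′ → ℚP.<-irrefl e′ hj<0)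
            where
            h′j≡0 : h′ j ≡ 0ℚ
            h′j≡0 = begin
              h j - δ i t j + δ j t j ≡⟨ cong₂ (λ a b → h j - a + b) (δ-other t (λ e′ → i≢j (sym e′))) (δ-same j t) ⟩
              h j - 0ℚ + t           ≡⟨ cong (λ s → h j - 0ℚ + s) (trans t≡bound e) ⟩
              h j - 0ℚ + - h j       ≡⟨ trans (cong (_+ - h j) (ℚP.+-identityʳ (h j))) (ℚP.+-inverseʳ (h j)) ⟩
              0ℚ                     ∎
              where open ≡-Reasoning

        inCone-cut : ∀ V → Cut V → t ≡ subsetSum V h → InCone p h
        inCone-cut V (V↑ , Vi , Vj) t≡ =
          cone-cong (λ k → trans (h≡h′+edge k) (cong (_+ (δ i t k - δ j t k)) (sym (restrict-∁ V h′ k))))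
                    (cone-+ (cone-+ inside outside) edge)
          where
          tight : subsetSum V h′ ≡ 0ℚ
          tight = begin
            subsetSum V h′
              ≡⟨ subsetSum-shift V h i j t ⟩
            subsetSum V h - (if V i then t else 0ℚ) + (if V j then t else 0ℚ)
              ≡⟨ cong₂ (λ a b → subsetSum V h - (if a then t else 0ℚ) + (if b then t else 0ℚ)) Vi Vj ⟩
            subsetSum V h - t + 0ℚ
              ≡⟨ ℚP.+-identityʳ _ ⟩
            subsetSum V h - t
              ≡⟨ cong (_- t) (sym t≡) ⟩
            t - t
              ≡⟨ ℚP.+-inverseʳ t ⟩
            0ℚ
              ∎
            where open ≡-Reasoning
          restrict⊆h : ∀ W k → restrict W h′ k ≢ 0ℚ → h k ≢ 0ℚ
          restrict⊆h W k r≢0 with W k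
          ... | true  = h′⊆h k r≢0
          ... | false = ⊥-elim (r≢0 refl)
          inside : InCone p (restrict V h′)
          inside = IH (restrict V h′)
                      (support-< (restrict⊆h V) j (cong (λ b → if b then h′ j else 0ℚ) Vj) (λ e → ℚP.<-irrefl e hj<0))
                      tight
                      (λ U U↑ → subst (0ℚ ≤_) (sym (subsetSum-restrict U V h′)) (h′-nonneg (U ∩ V) (upset-∩ {p = p} U↑ V↑)))
          outside-sum : sumℚ (restrict (∁ V) h′) ≡ 0ℚ
          outside-sum = begin
            subsetSum (∁ V) h′                  ≡⟨ sym (ℚP.+-identityˡ _) ⟩
            0ℚ + subsetSum (∁ V) h′             ≡⟨ cong (_+ subsetSum (∁ V) h′) (sym tight) ⟩
            subsetSum V h′ + subsetSum (∁ V) h′ ≡⟨ subsetSum-∁ V h′ ⟩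
            sumℚ h′                             ≡⟨ h′-sum ⟩
            0ℚ                                  ∎
            where open ≡-Reasoning
          outside-mass : ∀ U → subsetSum U (restrict (∁ V) h′) ≡ subsetSum (U ∪ V) h′
          outside-mass U = begin
            subsetSum U (restrict (∁ V) h′)         ≡⟨ subsetSum-restrict U (∁ V) h′ ⟩
            subsetSum (U ∩ ∁ V) h′                  ≡⟨ sym (ℚP.+-identityʳ _) ⟩
            subsetSum (U ∩ ∁ V) h′ + 0ℚ             ≡⟨ cong (subsetSum (U ∩ ∁ V) h′ +_) (sym tight) ⟩
            subsetSum (U ∩ ∁ V) h′ + subsetSum V h′ ≡⟨ subsetSum-∖∪ U V h′ ⟩
            subsetSum (U ∪ V) h′                    ∎
            where open ≡-Reasoning
          outside : InCone p (restrict (∁ V) h′)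
          outside = IH (restrict (∁ V) h′)
                       (support-< (restrict⊆h (∁ V)) i (cong (λ b → if not b then h′ i else 0ℚ) Vi)
                                  (λ e → ℚP.<-irrefl (sym e) 0<hi))
                       outside-sum
                       (λ U U↑ → subst (0ℚ ≤_) (sym (outside-mass U)) (h′-nonneg (U ∪ V) (upset-∪ {p = p} U↑ V↑)))

        inCone : InCone p h
        inCone with minOver-attained cutMass
        ... | V , t≡ with lem {Cut V}
        ...   | yes cut = inCone-cut V cut t≡
        ...   | no  _   = inCone-bound t≡

      inCone : ∀ {k} → h k ≢ 0ℚ → InCone p h
      inCone hk≢0 =
        let (j , hj<0) = sink hk≢0
            (i , i≥j , i≢j , 0<hi) = source hj<0
        in Transfer.inCone i≥j i≢j 0<hi hj<0

    gale-acc : ∀ h → Acc ℕ._<_ (support h) → sumℚ h ≡ 0ℚ → UpsetsNonneg p h → InCone p h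
    gale-acc h (acc smaller) sum0 nonneg with FinP.all? (λ k → h k ≟ 0ℚ)
    ... | yes h≡0 = cone-zero h≡0
    ... | no  h≢0 = Reduction.inCone h sum0 nonneg (λ g g<h → gale-acc g (smaller g<h))
                      (proj₂ (FinP.¬∀⟶∃¬ n _ (λ k → h k ≟ 0ℚ) h≢0))

    gale : ∀ h → sumℚ h ≡ 0ℚ → UpsetsNonneg p h → InCone p h
    gale h = gale-acc h (<-wellFounded (support h))

  subsetSum-improper : ∀ {n} {U : Subset n} (h : Fin n → ℚ) → InT h → ¬ ProperNonempty U → subsetSum U h ≡ 0ℚ
  subsetSum-improper {U = U} h sum0 improper with FinP.any? (λ i → U i Data.Bool.≟ true)
  ... | yes inhabited = trans (subsetSum-full h full) sum0
    where
    full : ∀ i → U i ≡ true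
    full i with U i in Ui
    ... | true  = refl
    ... | false = ⊥-elim (improper (inhabited , (i , Ui)))
  ... | no empty = subsetSum-∅ h (λ i → BoolP.¬-not (λ Ui → empty (i , Ui)))

  module _ (lem : ExcludedMiddle 0ℓ) {n} (p : Preposet n) where

    positive⇒upsets-nonneg : ∀ {h} → InT h → Positive p h → UpsetsNonneg p h
    positive⇒upsets-nonneg {h} sum0 pos U U↑ with lem {ProperNonempty U}
    ... | yes proper   = ℚP.<⇒≤ (pos U proper U↑)
    ... | no  improper = ℚP.≤-reflexive (sym (subsetSum-improper h sum0 improper))

    chamberInCone⇒positive : ∀ {h} → Generic h → ChamberInCone p h → Positive p h
    chamberInCone⇒positive {h} gen inCone U proper U↑ =
      ≤∧≢⇒< (inCone⇒upset-nonneg {p = p} (inCone h gen (λ _ _ → (λ x → x) , (λ x → x))) U↑)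
            (λ e → proj₂ gen U proper (sym e))

    positive⇒chamberInCone : ∀ {h} → Positive p h → ChamberInCone p h
    positive⇒chamberInCone pos h′ gen′ same =
      Gale.gale lem p h′ (proj₁ gen′)
        (positive⇒upsets-nonneg (proj₁ gen′) (λ U proper U↑ → proj₁ (same U proper) (pos U proper U↑)))

module Indicators where

  open Sums using (true≢false)
  open Classical
  open Cones
  open import Level using (0ℓ)
  open import Axiom.ExcludedMiddle using (ExcludedMiddle)
  open import Data.Nat using (ℕ; zero; suc; _<_; z≤n; s≤s)
  open import Data.Bool using (Bool; true; false; if_then_else_)
  open import Data.Product using (_×_; _,_; proj₁; proj₂)
  open import Data.Sum using (_⊎_; inj₁; inj₂; [_,_])
  open import Data.Empty using (⊥-elim)
  open import Data.List using (List; []; _∷_; _++_; map; foldr)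
  import Data.List.Relation.Unary.All as All
  open import Data.List.Relation.Unary.AllPairs using (AllPairs; []; _∷_)
  open import Data.List.Relation.Unary.Any using (here; there)
  open import Data.List.Membership.Propositional using (_∈_)
  open import Relation.Nullary using (¬_; yes; no)
  import Relation.Binary.PropositionalEquality as ≡
  import Algebra.Properties.Ring as RingProperties

  signs : ℕ → List (List Bool)
  signs zero    = [] ∷ []
  signs (suc k) = map (true ∷_) (signs k) ++ map (false ∷_) (signs k)

  -- sign vectors are padded with "true" beyond their length
  signAt : List Bool → ℕ → Bool
  signAt []      _       = true
  signAt (b ∷ s) zero    = b
  signAt (b ∷ s) (suc t) = signAt s t

  Always : ℕ → (ℕ → Set) → Set
  Always k T = ∀ t → t < k → T t

  Forces : ℕ → (ℕ → Set) → List Bool → Set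
  Forces k T s = ∀ t → t < k → T t → signAt s t ≡.≡ true

  module _ {c ℓ} (K : CharZeroField c ℓ) (lem : ExcludedMiddle 0ℓ) where
    open CharZeroField K hiding (zero)
    open RingProperties ring using (-0#≈0#; -‿+-comm; -‿distribˡ-*)
    open import Relation.Binary.Reasoning.Setoid setoid
    open import Algebra.Properties.CommutativeSemigroup +-commutativeSemigroup using (interchange)

    x+y≈z⇒x≈z-y : ∀ {x y z} → x + y ≈ z → x ≈ z + - y
    x+y≈z⇒x≈z-y {x} {y} e = begin
      x               ≈⟨ sym (+-identityʳ x) ⟩
      x + 0#          ≈⟨ +-cong refl (sym (-‿inverseʳ y)) ⟩
      x + (y + - y)   ≈⟨ sym (+-assoc x y (- y)) ⟩
      (x + y) + - y   ≈⟨ +-cong e refl ⟩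
      _               ∎

    𝟙 : Set → Carrier
    𝟙 P = if holds lem P then 1# else 0#

    𝟙-yes : ∀ {P} → P → 𝟙 P ≡.≡ 1#
    𝟙-yes p = ≡.cong (λ b → if b then 1# else 0#) (holds-intro lem p)

    𝟙-no : ∀ {P} → ¬ P → 𝟙 P ≡.≡ 0#
    𝟙-no ¬p = ≡.cong (λ b → if b then 1# else 0#) (holds-intro¬ lem ¬p)

    𝟙-cong : ∀ {P Q} → (P → Q) → (Q → P) → 𝟙 P ≡.≡ 𝟙 Q
    𝟙-cong to from = ≡.cong (λ b → if b then 1# else 0#) (holds-cong lem to from)

    č≡𝟙 : ∀ {n} (p : Preposet n) {h} → Generic h → č K lem p h ≡.≡ 𝟙 (Positive p h)
    č≡𝟙 p {h} gen with lem {ChamberInCone p h}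
    ... | yes inCone = ≡.sym (𝟙-yes (chamberInCone⇒positive lem p gen inCone))
    ... | no ¬inCone = ≡.sym (𝟙-no (λ pos → ¬inCone (positive⇒chamberInCone lem p pos)))

    𝟙-×⊎ : ∀ {P Q} → 𝟙 (P × Q) + 𝟙 (P ⊎ Q) ≈ 𝟙 P + 𝟙 Q
    𝟙-×⊎ {P} {Q} with lem {P} | lem {Q}
    ... | yes p | yes q rewrite 𝟙-yes (p , q)            | 𝟙-yes {P ⊎ Q} (inj₁ p) = refl
    ... | yes p | no ¬q rewrite 𝟙-no {P × Q} (λ pq → ¬q (proj₂ pq)) | 𝟙-yes {P ⊎ Q} (inj₁ p) = +-comm 0# 1#
    ... | no ¬p | yes q rewrite 𝟙-no {P × Q} (λ pq → ¬p (proj₁ pq)) | 𝟙-yes {P ⊎ Q} (inj₂ q) = refl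
    ... | no ¬p | no ¬q rewrite 𝟙-no {P × Q} (λ pq → ¬p (proj₁ pq)) | 𝟙-no {P ⊎ Q} [ ¬p , ¬q ] = refl

    𝟙-split : ∀ {P Q} → 𝟙 (P × Q) + 𝟙 (P × ¬ Q) ≈ 𝟙 P
    𝟙-split {P} {Q} with lem {P} | lem {Q}
    ... | yes p | yes q rewrite 𝟙-yes (p , q) | 𝟙-no {P × ¬ Q} (λ x → proj₂ x q) = +-identityʳ 1#
    ... | yes p | no ¬q rewrite 𝟙-no {P × Q} (λ x → ¬q (proj₂ x)) | 𝟙-yes (p , ¬q) = +-identityˡ 1#
    ... | no ¬p | _     rewrite 𝟙-no {P × Q} (λ x → ¬p (proj₁ x)) | 𝟙-no {P × ¬ Q} (λ x → ¬p (proj₁ x)) = +-identityˡ 0#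

    ∑ : ∀ {a} {A : Set a} → List A → (A → Carrier) → Carrier
    ∑ xs f = foldr (λ x acc → f x + acc) 0# xs

    module _ {a} {A : Set a} where

      ∑-cong : ∀ (xs : List A) {f g} → (∀ {x} → x ∈ xs → f x ≈ g x) → ∑ xs f ≈ ∑ xs g
      ∑-cong []       e = refl
      ∑-cong (x ∷ xs) e = +-cong (e (here ≡.refl)) (∑-cong xs (λ x∈ → e (there x∈)))

      ∑-++ : ∀ (xs ys : List A) f → ∑ (xs ++ ys) f ≈ ∑ xs f + ∑ ys f
      ∑-++ []       ys f = sym (+-identityˡ _)
      ∑-++ (x ∷ xs) ys f = trans (+-cong refl (∑-++ xs ys f)) (sym (+-assoc _ _ _))

      ∑-map : ∀ {b} {B : Set b} (xs : List B) (g : B → A) f → ∑ (map g xs) f ≡.≡ ∑ xs (λ x → f (g x))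
      ∑-map []       g f = ≡.refl
      ∑-map (x ∷ xs) g f = ≡.cong (f (g x) +_) (∑-map xs g f)

      ∑-0 : ∀ (xs : List A) {f} → (∀ {x} → x ∈ xs → f x ≈ 0#) → ∑ xs f ≈ 0#
      ∑-0 []       z = refl
      ∑-0 (x ∷ xs) z = trans (+-cong (z (here ≡.refl)) (∑-0 xs (λ x∈ → z (there x∈)))) (+-identityˡ 0#)

      ∑-+ : ∀ (xs : List A) f g → ∑ xs (λ x → f x + g x) ≈ ∑ xs f + ∑ xs g
      ∑-+ []       f g = sym (+-identityˡ 0#)
      ∑-+ (x ∷ xs) f g = trans (+-cong refl (∑-+ xs f g)) (interchange (f x) (g x) (∑ xs f) (∑ xs g))

      ∑-*ˡ : ∀ (xs : List A) b f → ∑ xs (λ x → b * f x) ≈ b * ∑ xs f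
      ∑-*ˡ []       b f = sym (zeroʳ b)
      ∑-*ˡ (x ∷ xs) b f = trans (+-cong refl (∑-*ˡ xs b f)) (sym (distribˡ b (f x) (∑ xs f)))

      ∑-single : ∀ {R : A → A → Set} (xs : List A) f {x} → AllPairs R xs → x ∈ xs →
        (∀ {y} → y ∈ xs → R x y ⊎ R y x → f y ≈ 0#) → ∑ xs f ≈ f x
      ∑-single (_ ∷ xs) f (Rx ∷ pairs) (here ≡.refl) others =
        trans (+-cong refl (∑-0 xs (λ y∈ → others (there y∈) (inj₁ (All.lookup Rx y∈))))) (+-identityʳ _)
      ∑-single (_ ∷ xs) f (Rz ∷ pairs) (there x∈) others =
        trans (+-cong (others (here ≡.refl) (inj₂ (All.lookup Rz x∈)))
                      (∑-single xs f pairs x∈ (λ y∈ → others (there y∈))))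
              (+-identityˡ _)

      ∑-neg : ∀ (xs : List A) f → ∑ xs (λ x → - f x) ≈ - ∑ xs f
      ∑-neg []       f = sym -0#≈0#
      ∑-neg (x ∷ xs) f = trans (+-cong refl (∑-neg xs f)) (-‿+-comm (f x) (∑ xs f))

    sgn : List Bool → Carrier
    sgn []           = 1#
    sgn (true  ∷ s) = sgn s
    sgn (false ∷ s) = - sgn s

    ∑-sgn-𝟙 : ∀ k (A : Set) (T : ℕ → Set) →
      ∑ (signs k) (λ s → sgn s * 𝟙 (A × Forces k T s)) ≈ 𝟙 (A × Always k T)
    ∑-sgn-𝟙 zero A T =
      trans (+-identityʳ _) (trans (*-identityˡ _) (reflexive (𝟙-cong (λ (a , _) → a , λ _ ()) (λ (a , _) → a , λ _ ()))))
    ∑-sgn-𝟙 (suc k) A T = begin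
      ∑ (map (true ∷_) S ++ map (false ∷_) S) f
        ≈⟨ ∑-++ (map (true ∷_) S) _ f ⟩
      ∑ (map (true ∷_) S) f + ∑ (map (false ∷_) S) f
        ≡⟨ ≡.cong₂ _+_ (∑-map S (true ∷_) f) (∑-map S (false ∷_) f) ⟩
      ∑ S (λ s → f (true ∷ s)) + ∑ S (λ s → f (false ∷ s))
        ≈⟨ +-cong (∑-cong S (λ {s} _ → head-true s)) (trans (∑-cong S (λ {s} _ → head-false s)) (∑-neg S _)) ⟩
      ∑ S (λ s → sgn s * 𝟙 (A × Forces k T′ s)) + - ∑ S (λ s → sgn s * 𝟙 ((A × ¬ T 0) × Forces k T′ s))
        ≈⟨ +-cong (∑-sgn-𝟙 k A T′) (-‿cong (∑-sgn-𝟙 k (A × ¬ T 0) T′)) ⟩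
      𝟙 (A × Always k T′) + - 𝟙 ((A × ¬ T 0) × Always k T′)
        ≈⟨ +-cong (sym 𝟙-split) (-‿cong (reflexive (𝟙-cong reassoc reassoc⁻¹))) ⟩
      (𝟙 ((A × Always k T′) × T 0) + 𝟙 ((A × Always k T′) × ¬ T 0)) + - 𝟙 ((A × Always k T′) × ¬ T 0)
        ≈⟨ sym (x+y≈z⇒x≈z-y refl) ⟩
      𝟙 ((A × Always k T′) × T 0)
        ≡⟨ 𝟙-cong combine split ⟩
      𝟙 (A × Always (suc k) T)
        ∎
      where
      S : List (List Bool)
      S = signs k
      T′ : ℕ → Set
      T′ t = T (suc t)
      f : List Bool → Carrier
      f s = sgn s * 𝟙 (A × Forces (suc k) T s)
      head-true : ∀ s → f (true ∷ s) ≈ sgn s * 𝟙 (A × Forces k T′ s)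
      head-true s = *-cong refl (reflexive (𝟙-cong
        (λ (a , g) → a , λ t t<k Tt → g (suc t) (s≤s t<k) Tt)
        (λ (a , g) → a , λ { zero _ _ → ≡.refl ; (suc t) (s≤s t<k) Tt → g t t<k Tt })))
      head-false : ∀ s → f (false ∷ s) ≈ - (sgn s * 𝟙 ((A × ¬ T 0) × Forces k T′ s))
      head-false s = trans (*-cong refl (reflexive (𝟙-cong
        (λ (a , g) → (a , λ T0 → true≢false (≡.sym (g zero (s≤s z≤n) T0))) , λ t t<k Tt → g (suc t) (s≤s t<k) Tt)
        (λ ((a , ¬T0) , g) → a , λ { zero _ T0 → ⊥-elim (¬T0 T0) ; (suc t) (s≤s t<k) Tt → g t t<k Tt }))))
        (sym (-‿distribˡ-* (sgn s) _))
      reassoc : (A × ¬ T 0) × Always k T′ → (A × Always k T′) × ¬ T 0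
      reassoc ((a , ¬T0) , g) = (a , g) , ¬T0
      reassoc⁻¹ : (A × Always k T′) × ¬ T 0 → (A × ¬ T 0) × Always k T′
      reassoc⁻¹ ((a , g) , ¬T0) = (a , ¬T0) , g
      combine : (A × Always k T′) × T 0 → A × Always (suc k) T
      combine ((a , g) , T0) = a , λ { zero _ → T0 ; (suc t) (s≤s t<k) → g t t<k }
      split : A × Always (suc k) T → (A × Always k T′) × T 0
      split (a , g) = (a , λ t t<k → g (suc t) (s≤s t<k)) , g zero (s≤s z≤n)

module Extensions where

  open Sums
  open Cones
  open import Level using (0ℓ)
  open import Axiom.ExcludedMiddle using (ExcludedMiddle)
  open import Data.Fin using (Fin)
  open import Data.Bool using (true; false)
  open import Data.Product using (∃; _×_; _,_; proj₁; proj₂)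
  open import Data.Sum using (_⊎_; inj₁; inj₂)
  open import Data.Empty using (⊥; ⊥-elim)
  open import Relation.Nullary using (¬_; yes; no)
  open import Relation.Binary.PropositionalEquality
  open import Data.Rational using (0ℚ; _+_; _<_; _≤_)
  import Data.Rational.Properties as ℚP

  module _ {n} (p : Preposet n) where
    open Preposet p using (rel) renaming (refl to rel-refl; trans to rel-trans)

    extend : Fin n → Fin n → Preposet n
    extend x y = record
      { rel   = R
      ; refl  = λ a → inj₁ (rel-refl a)
      ; trans = compose }
      where
      R : Fin n → Fin n → Set
      R a b = rel a b ⊎ (rel a x × rel y b)
      compose : ∀ {a b c} → R a b → R b c → R a c
      compose (inj₁ ab)        (inj₁ bc)        = inj₁ (rel-trans ab bc)
      compose (inj₁ ab)        (inj₂ (bx , yc)) = inj₂ (rel-trans ab bx , yc)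
      compose (inj₂ (ax , yb)) (inj₁ bc)        = inj₂ (ax , rel-trans yb bc)
      compose (inj₂ (ax , yb)) (inj₂ (bx , yc)) = inj₂ (ax , yc)

    identify : Fin n → Fin n → Preposet n
    identify x y = record
      { rel   = R
      ; refl  = λ a → inj₁ (rel-refl a)
      ; trans = compose }
      where
      R : Fin n → Fin n → Set
      R a b = rel a b ⊎ (rel a x × rel y b) ⊎ (rel a y × rel x b)
      compose : ∀ {a b c} → R a b → R b c → R a c
      compose (inj₁ ab)               (inj₁ bc)               = inj₁ (rel-trans ab bc)
      compose (inj₁ ab)               (inj₂ (inj₁ (bx , yc))) = inj₂ (inj₁ (rel-trans ab bx , yc))
      compose (inj₁ ab)               (inj₂ (inj₂ (by , xc))) = inj₂ (inj₂ (rel-trans ab by , xc))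
      compose (inj₂ (inj₁ (ax , yb))) (inj₁ bc)               = inj₂ (inj₁ (ax , rel-trans yb bc))
      compose (inj₂ (inj₂ (ay , xb))) (inj₁ bc)               = inj₂ (inj₂ (ay , rel-trans xb bc))
      compose (inj₂ (inj₁ (ax , yb))) (inj₂ (inj₁ (bx , yc))) = inj₂ (inj₁ (ax , yc))
      compose (inj₂ (inj₁ (ax , yb))) (inj₂ (inj₂ (by , xc))) = inj₁ (rel-trans ax xc)
      compose (inj₂ (inj₂ (ay , xb))) (inj₂ (inj₁ (bx , yc))) = inj₁ (rel-trans ay yc)
      compose (inj₂ (inj₂ (ay , xb))) (inj₂ (inj₂ (by , xc))) = inj₂ (inj₂ (ay , xc))

    module _ (x y : Fin n) where

      upset-extend⁻ : ∀ {V} → IsUpset (extend x y) V → IsUpset p V × (V y ≡ true → V x ≡ true)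
      upset-extend⁻ V↑ = (λ a b Va r → V↑ a b Va (inj₁ r)) ,
                         (λ Vy → V↑ y x Vy (inj₂ (rel-refl x , rel-refl y)))

      upset-extend⁺ : ∀ {V} → IsUpset p V → (V y ≡ true → V x ≡ true) → IsUpset (extend x y) V
      upset-extend⁺ V↑ y⇒x a b Va (inj₁ r)         = V↑ a b Va r
      upset-extend⁺ V↑ y⇒x a b Va (inj₂ (bx , ya)) = V↑ x b (y⇒x (V↑ a y Va ya)) bx

      upset-identify⁻ : ∀ {V} → IsUpset (identify x y) V →
        IsUpset p V × (V y ≡ true → V x ≡ true) × (V x ≡ true → V y ≡ true)
      upset-identify⁻ V↑ = (λ a b Va r → V↑ a b Va (inj₁ r)) ,
                           (λ Vy → V↑ y x Vy (inj₂ (inj₁ (rel-refl x , rel-refl y)))) ,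
                           (λ Vx → V↑ x y Vx (inj₂ (inj₂ (rel-refl y , rel-refl x))))

      upset-identify⁺ : ∀ {V} → IsUpset p V → (V y ≡ true → V x ≡ true) → (V x ≡ true → V y ≡ true) →
        IsUpset (identify x y) V
      upset-identify⁺ V↑ y⇒x x⇒y a b Va (inj₁ r)                = V↑ a b Va r
      upset-identify⁺ V↑ y⇒x x⇒y a b Va (inj₂ (inj₁ (bx , ya))) = V↑ x b (y⇒x (V↑ a y Va ya)) bx
      upset-identify⁺ V↑ y⇒x x⇒y a b Va (inj₂ (inj₂ (by , xa))) = V↑ y b (x⇒y (V↑ a x Va xa)) by

    positive-extend : ∀ x y {h} → Positive p h → Positive (extend x y) h
    positive-extend x y = positive-mono {p = extend x y} {q = p} (λ _ _ → inj₁)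

    positive-extend⁻ : ∀ x y {h} → Positive (extend x y) h → Positive (extend y x) h → Positive p h
    positive-extend⁻ x y pos₁ pos₂ V proper V↑ with V y in Vy | V x in Vx
    ... | true  | true  = pos₁ V proper (upset-extend⁺ x y V↑ (λ _ → Vx))
    ... | false | _     = pos₁ V proper (upset-extend⁺ x y V↑ (λ Vy′ → ⊥-elim (true≢false (trans (sym Vy′) Vy))))
    ... | true  | false = pos₂ V proper (upset-extend⁺ y x V↑ (λ _ → Vy))

    positive-identify : ∀ x y {h} → Positive (extend x y) h ⊎ Positive (extend y x) h → Positive (identify x y) h
    positive-identify x y (inj₁ pos) V proper V↑ =
      let (V↑p , y⇒x , _) = upset-identify⁻ x y V↑ in pos V proper (upset-extend⁺ x y V↑p y⇒x)
    positive-identify x y (inj₂ pos) V proper V↑ =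
      let (V↑p , _ , x⇒y) = upset-identify⁻ x y V↑ in pos V proper (upset-extend⁺ y x V↑p x⇒y)

  module _ (lem : ExcludedMiddle 0ℓ) {n} (p : Preposet n) where

    negative-upset : ∀ {q : Preposet n} {h} → Generic h → ¬ Positive q h →
      ∃ λ V → ProperNonempty V × IsUpset q V × subsetSum V h < 0ℚ
    negative-upset {q} {h} gen ¬pos with lem {∃ λ V → ProperNonempty V × IsUpset q V × ¬ (0ℚ < subsetSum V h)}
    ... | yes (V , proper , V↑ , ¬0<) = V , proper , V↑ , ≮∧≢⇒> ¬0< (λ e → proj₂ gen V proper (sym e))
    ... | no  none = ⊥-elim (¬pos λ V proper V↑ → by-contradiction V proper V↑)
      where
      by-contradiction : ∀ V → ProperNonempty V → IsUpset q V → 0ℚ < subsetSum V h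
      by-contradiction V proper V↑ with 0ℚ ℚP.<? subsetSum V h
      ... | yes 0< = 0<
      ... | no ¬0< = ⊥-elim (none (V , proper , V↑ , ¬0<))

    separates : ∀ x y {h} {V} → Positive (identify p x y) h → IsUpset (extend p x y) V → ProperNonempty V →
      subsetSum V h < 0ℚ → V x ≡ true × V y ≡ false
    separates x y {V = V} pos V↑ proper neg = by-cases (V x) (V y) refl refl
      where
      V↑p : IsUpset p V
      V↑p = proj₁ (upset-extend⁻ p x y V↑)
      y⇒x : V y ≡ true → V x ≡ true
      y⇒x = proj₂ (upset-extend⁻ p x y V↑)
      not-identified : ¬ (V x ≡ true → V y ≡ true)
      not-identified x⇒y = ℚP.<-asym neg (pos V proper (upset-identify⁺ p x y V↑p y⇒x x⇒y))
      by-cases : ∀ a b → V x ≡ a → V y ≡ b → V x ≡ true × V y ≡ false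
      by-cases true  false Vx Vy = Vx , Vy
      by-cases true  true  _  Vy = ⊥-elim (not-identified (λ _ → Vy))
      by-cases false _     Vx _  = ⊥-elim (not-identified (λ Vx′ → ⊥-elim (true≢false (trans (sym Vx′) Vx))))

    -- V ∩ W misses both x and y and V ∪ W contains both, so both are upsets of p
    -- with x ~ y; submodularity then makes one of them negative
    opposite-cuts : ∀ x y {h} {V W} → InT h → Positive (identify p x y) h →
      IsUpset p V → V x ≡ true → V y ≡ false → subsetSum V h < 0ℚ →
      IsUpset p W → W y ≡ true → W x ≡ false → subsetSum W h < 0ℚ → ⊥
    opposite-cuts x y {h} {V} {W} sum0 pos V↑ Vx Vy V-neg W↑ Wy Wx W-neg =
      ℚP.<-irrefl (subsetSum-∩∪ V W h)
        (ℚP.<-≤-trans (subst (subsetSum V h + subsetSum W h <_) (ℚP.+-identityʳ 0ℚ) (ℚP.+-mono-< V-neg W-neg))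
                      (subst (_≤ subsetSum (V ∩ W) h + subsetSum (V ∪ W) h) (ℚP.+-identityʳ 0ℚ)
                             (ℚP.+-mono-≤ (nonneg (V ∩ W) ∩-upset) (nonneg (V ∪ W) ∪-upset))))
      where
      nonneg : UpsetsNonneg (identify p x y) h
      nonneg = positive⇒upsets-nonneg lem (identify p x y) sum0 pos
      V∩W-x : (V ∩ W) x ≡ false
      V∩W-x rewrite Vx | Wx = refl
      V∩W-y : (V ∩ W) y ≡ false
      V∩W-y rewrite Vy = refl
      V∪W-x : (V ∪ W) x ≡ true
      V∪W-x rewrite Vx = refl
      V∪W-y : (V ∪ W) y ≡ true
      V∪W-y rewrite Vy | Wy = refl
      ∩-upset : IsUpset (identify p x y) (V ∩ W)
      ∩-upset = upset-identify⁺ p x y (upset-∩ {p = p} V↑ W↑)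
        (λ e → ⊥-elim (true≢false (trans (sym e) V∩W-y))) (λ e → ⊥-elim (true≢false (trans (sym e) V∩W-x)))
      ∪-upset : IsUpset (identify p x y) (V ∪ W)
      ∪-upset = upset-identify⁺ p x y (upset-∪ {p = p} V↑ W↑) (λ _ → V∪W-x) (λ _ → V∪W-y)

    positive-identify⁻ : ∀ x y {h} → Generic h → Positive (identify p x y) h →
      Positive (extend p x y) h ⊎ Positive (extend p y x) h
    positive-identify⁻ x y {h} gen pos with lem {Positive (extend p x y) h} | lem {Positive (extend p y x) h}
    ... | yes pos₁ | _        = inj₁ pos₁
    ... | no  _    | yes pos₂ = inj₂ pos₂
    ... | no ¬pos₁ | no ¬pos₂ with negative-upset {extend p x y} gen ¬pos₁ | negative-upset {extend p y x} gen ¬pos₂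
    ...   | V , V-proper , V↑ , V-neg | W , W-proper , W↑ , W-neg =
      let (Vx , Vy) = separates x y pos V↑ V-proper V-neg
          (Wy , Wx) = separates y x (identify-swap pos) W↑ W-proper W-neg
      in ⊥-elim (opposite-cuts x y (proj₁ gen) pos (proj₁ (upset-extend⁻ p x y V↑)) Vx Vy V-neg
                                                    (proj₁ (upset-extend⁻ p y x W↑)) Wy Wx W-neg)
      where
      identify-swap : Positive (identify p x y) h → Positive (identify p y x) h
      identify-swap pos U proper U↑ =
        let (U↑p , x⇒y , y⇒x) = upset-identify⁻ p y x U↑ in pos U proper (upset-identify⁺ p x y U↑p y⇒x x⇒y)

module Compositions where

  open Sums
  open Counting
  open Classical
  open Cones
  open import Level using (0ℓ)
  open import Axiom.ExcludedMiddle using (ExcludedMiddle)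
  open import Data.Nat as ℕ using (ℕ; zero; suc; _≤_; _<_; _+_; z≤n; s≤s; pred)
  import Data.Nat.Properties as ℕP
  open import Data.Fin as Fin using (Fin; toℕ)
  import Data.Fin.Properties as FinP
  open import Data.Bool using (Bool; true; false; _∨_; _∧_; not)
  import Data.Bool.Properties as BoolP
  open import Data.Product using (∃; _×_; _,_; proj₁; proj₂)
  open import Data.Sum using (_⊎_; inj₁; inj₂)
  open import Data.Empty using (⊥; ⊥-elim)
  open import Relation.Nullary using (¬_; Dec; yes; no; does)
  open import Relation.Nullary.Decidable using (dec-true; dec-false)
  open import Relation.Binary.PropositionalEquality
  open import Data.Rational using (0ℚ) renaming (_+_ to _+ℚ_)
  open import Data.Rational using () renaming (_<_ to _<ℚ_; _≤_ to _≤ℚ_)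
  import Data.Rational.Properties as ℚP

  module FromTotal (lem : ExcludedMiddle 0ℓ) {n} (p : Preposet n)
                   (total : ∀ x y → Preposet.rel p x y ⊎ Preposet.rel p y x) where
    open Preposet p using (rel) renaming (refl to rel-refl; trans to rel-trans)

    Equiv : Fin n → Fin n → Set
    Equiv x y = rel x y × rel y x

    IsRep : Fin n → Set
    IsRep r = ∀ z → Equiv z r → toℕ r ≤ toℕ z

    rep-exists : ∀ x → ∃ λ r → Equiv r x × IsRep r
    rep-exists x with argmin (λ z → holds lem (Equiv z x)) toℕ (x , holds-intro lem (rel-refl x , rel-refl x))
    ... | r , r~x , least = r , holds-elim lem r~x ,
          λ z (z≥r , r≥z) → least z (holds-intro lem (rel-trans z≥r (proj₁ (holds-elim lem r~x)) ,
                                                      rel-trans (proj₂ (holds-elim lem r~x)) r≥z))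

    rep-unique : ∀ {r r′} → IsRep r → IsRep r′ → Equiv r r′ → r ≡ r′
    rep-unique r-rep r′-rep (r≥r′ , r′≥r) =
      FinP.toℕ-injective (ℕP.≤-antisym (r-rep _ (r′≥r , r≥r′)) (r′-rep _ (r≥r′ , r′≥r)))

    Before : Fin n → Fin n → Set
    Before i z = IsRep z × rel z i × ¬ rel i z

    Before-mono : ∀ {i j z} → rel i j → Before i z → Before j z
    Before-mono i≥j (z-rep , z≥i , i≱z) = z-rep , rel-trans z≥i i≥j , (λ j≥z → i≱z (rel-trans i≥j j≥z))

    before? : Fin n → Fin n → Bool
    before? i z = holds lem (Before i z)

    lump : Fin n → ℕ
    lump i = count (before? i)

    rel⇒lump≤ : ∀ {i j} → rel i j → lump i ≤ lump j
    rel⇒lump≤ {i} {j} i≥j =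
      count-mono {f = before? i} {g = before? j} (λ z e → holds-intro lem (Before-mono i≥j (holds-elim lem e)))

    lump-strict : ∀ {i j} → ¬ rel i j → lump j < lump i
    lump-strict {i} {j} i≱j with total i j
    ... | inj₁ i≥j = ⊥-elim (i≱j i≥j)
    ... | inj₂ j≥i with rep-exists j
    ...   | r , (r≥j , j≥r) , r-rep =
      count-strict {f = before? j} {g = before? i} (λ z e → holds-intro lem (Before-mono j≥i (holds-elim lem e))) r
        (holds-intro¬ lem (λ (_ , _ , j≱r) → j≱r j≥r))
        (holds-intro lem (r-rep , rel-trans r≥j j≥i , (λ i≥r → i≱j (rel-trans i≥r r≥j))))

    lump≤⇒rel : ∀ {i j} → lump i ≤ lump j → rel i j
    lump≤⇒rel {i} {j} le with lem {rel i j}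
    ... | yes i≥j = i≥j
    ... | no  i≱j = ⊥-elim (ℕP.<-irrefl refl (ℕP.<-≤-trans (lump-strict i≱j) le))

    -- the classes before i are those before the last class before i, plus that class
    lump-pred : ∀ i k → lump i ≡ suc k → ∃ λ j → lump j ≡ k
    lump-pred i k e with argmax (λ z → holds lem (Before i z)) lump (count-pos _ (subst (0 <_) (sym e) (s≤s z≤n)))
    ... | j , j∈ , greatest =
      j , sym (ℕP.suc-injective (trans (sym e) (trans (count-cong same) (count-insert (before? j) j j∉))))
      where
      Bij : Before i j
      Bij = holds-elim lem j∈
      j∉ : before? j j ≡ false
      j∉ = holds-intro¬ lem (λ (_ , _ , j≱j) → j≱j (rel-refl j))
      same : ∀ z → before? i z ≡ before? j z ∨ does (z Fin.≟ j)
      same z with lem {Before i z} | lem {Before j z} | z Fin.≟ j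
      ... | yes _   | yes _ | _     = refl
      ... | no  _   | no  _ | no  _ = refl
      ... | yes Biz | no ¬Bjz | yes refl = refl
      ... | no ¬Biz | _       | yes refl = ⊥-elim (¬Biz Bij)
      ... | no ¬Biz | yes Bjz | no _ = ⊥-elim (¬Biz (Before-mono (proj₁ (proj₂ Bij)) Bjz))
      ... | yes Biz@(z-rep , z≥i , _) | no ¬Bjz | no z≢j with total j z
      ...   | inj₂ z≥j =
        ⊥-elim (¬Bjz (z-rep , z≥j , λ j≥z → z≢j (rep-unique z-rep (proj₁ Bij) (z≥j , j≥z))))
      ...   | inj₁ j≥z with lem {rel z j}
      ...     | yes z≥j = ⊥-elim (z≢j (rep-unique z-rep (proj₁ Bij) (z≥j , j≥z)))
      ...     | no  z≱j =
        ⊥-elim (ℕP.<-irrefl refl (ℕP.<-≤-trans (lump-strict z≱j) (greatest z (holds-intro lem Biz))))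

    no-gaps : ∀ i k → k < lump i → ∃ λ j → lump j ≡ k
    no-gaps i k k<lump with ℕP.m≤n⇒∃[o]m+o≡n k<lump
    ... | d , e = descend d i (trans (sym e) (sym (ℕP.+-suc k d)))
      where
      descend : ∀ d i → lump i ≡ k + suc d → ∃ λ j → lump j ≡ k
      descend zero    i e = lump-pred i k (trans e (ℕP.+-comm k 1))
      descend (suc d) i e with lump-pred i (k + suc d) (trans e (ℕP.+-suc k (suc d)))
      ... | j , e′ = descend d j e′

    toComposition : Composition n
    toComposition = record { lump = lump ; noGaps = no-gaps }

  module Merge (lem : ExcludedMiddle 0ℓ) {n} (F : Composition n) (i0 : Fin n) (m′ : ℕ)
               (L-i0 : Composition.lump F i0 ≡ suc m′) where

    L : Fin n → ℕ
    L = Composition.lump F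

    m : ℕ
    m = suc m′

    merge : ℕ → ℕ
    merge k with k ℕ.<? m
    ... | yes _ = k
    ... | no  _ = pred k

    merge-< : ∀ {k} → k < m → merge k ≡ k
    merge-< {k} k<m with k ℕ.<? m
    ... | yes _   = refl
    ... | no  k≮m = ⊥-elim (k≮m k<m)

    merge-≥ : ∀ {k} → m ≤ k → merge k ≡ pred k
    merge-≥ {k} m≤k with k ℕ.<? m
    ... | yes k<m = ⊥-elim (ℕP.<-irrefl refl (ℕP.<-≤-trans k<m m≤k))
    ... | no  _   = refl

    merge-≤ : ∀ k → merge k ≤ k
    merge-≤ k with k ℕ.<? m
    ... | yes _ = ℕP.≤-refl
    ... | no  _ = ℕP.pred[n]≤n {k}

    pred-cancel : ∀ {a b} → m ≤ a → m ≤ b → pred a ≤ pred b → a ≤ b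
    pred-cancel (s≤s _) (s≤s _) le = s≤s le

    merge-mono : ∀ {a b} → a ≤ b → merge a ≤ merge b
    merge-mono {a} {b} a≤b with a ℕ.<? m | b ℕ.<? m
    ... | yes _   | yes _   = a≤b
    ... | yes a<m | no  b≮m = ℕP.≤-trans (ℕP.≤-pred a<m) (ℕP.pred-mono-≤ (ℕP.≮⇒≥ b≮m))
    ... | no  a≮m | yes b<m = ⊥-elim (a≮m (ℕP.≤-<-trans a≤b b<m))
    ... | no  _   | no  _   = ℕP.pred-mono-≤ a≤b

    merge-collapse : ∀ {a b} → a < b → merge b ≤ merge a → a ≡ m′ × b ≡ m
    merge-collapse {a} {b} a<b mb≤ma with a ℕ.<? m | b ℕ.<? m
    ... | yes _   | yes _   = ⊥-elim (ℕP.<-irrefl refl (ℕP.<-≤-trans a<b mb≤ma))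
    ... | no  a≮m | yes b<m = ⊥-elim (a≮m (ℕP.<-trans a<b b<m))
    ... | no  a≮m | no  b≮m =
      ⊥-elim (ℕP.<-irrefl refl (ℕP.<-≤-trans a<b (pred-cancel (ℕP.≮⇒≥ b≮m) (ℕP.≮⇒≥ a≮m) mb≤ma)))
    ... | yes a<m | no  b≮m with b | ℕP.≮⇒≥ b≮m
    ...   | suc b′ | s≤s m′≤b′ =
      a≡m′ , cong suc (ℕP.≤-antisym (ℕP.≤-trans mb≤ma (ℕP.≤-reflexive a≡m′)) m′≤b′)
      where
      a≡m′ : a ≡ m′
      a≡m′ = ℕP.≤-antisym (ℕP.≤-pred a<m) (ℕP.≤-trans m′≤b′ mb≤ma)

    merged-no-gaps : ∀ i k → k < merge (L i) → ∃ λ j → merge (L j) ≡ k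
    merged-no-gaps i k k<M = by-cases (k ℕ.<? m) (L i ℕ.<? m)
      where
      suc-<pred : ∀ {k l} → m ≤ l → k < pred l → suc k < l
      suc-<pred {l = suc l} _ k<l = s≤s k<l
      by-cases : Dec (k < m) → Dec (L i < m) → ∃ λ j → merge (L j) ≡ k
      by-cases (yes k<m) _ with Composition.noGaps F i k (ℕP.<-≤-trans k<M (merge-≤ (L i)))
      ... | j , Lj≡k = j , trans (cong merge Lj≡k) (merge-< k<m)
      by-cases (no k≮m) (yes Li<m) = ⊥-elim (k≮m (ℕP.<-trans (subst (k <_) (merge-< Li<m) k<M) Li<m))
      by-cases (no k≮m) (no Li≮m)
        with Composition.noGaps F i (suc k)
               (suc-<pred (ℕP.≮⇒≥ Li≮m) (subst (k <_) (merge-≥ (ℕP.≮⇒≥ Li≮m)) k<M))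
      ... | j , Lj≡sk = j , trans (cong merge Lj≡sk) (merge-≥ (ℕP.m≤n⇒m≤1+n (ℕP.≮⇒≥ k≮m)))

    merged : Composition n
    merged = record { lump = λ x → merge (L x) ; noGaps = merged-no-gaps }

    -- F restricted to U and to its complement, joined only by lump m ≥ lump m′
    Twisted : Fin n → Fin n → Set
    Twisted x y = (L x ≤ L y × (m ≤ L x ⊎ L y < m)) ⊎ (L y ≡ m′ × L x ≡ m)

    twisted : Preposet n
    twisted = record { rel = Twisted ; refl = reflexive ; trans = compose }
      where
      reflexive : ∀ x → Twisted x x
      reflexive x with L x ℕ.<? m
      ... | yes Lx<m = inj₁ (ℕP.≤-refl , inj₂ Lx<m)
      ... | no  Lx≮m = inj₁ (ℕP.≤-refl , inj₁ (ℕP.≮⇒≥ Lx≮m))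
      compose : ∀ {x y z} → Twisted x y → Twisted y z → Twisted x z
      compose (inj₁ (xy , inj₁ m≤x)) (inj₁ (yz , _)) = inj₁ (ℕP.≤-trans xy yz , inj₁ m≤x)
      compose (inj₁ (xy , inj₂ y<m)) (inj₁ (yz , inj₁ m≤y)) = ⊥-elim (ℕP.<-irrefl refl (ℕP.<-≤-trans y<m m≤y))
      compose (inj₁ (xy , inj₂ y<m)) (inj₁ (yz , inj₂ z<m)) = inj₁ (ℕP.≤-trans xy yz , inj₂ z<m)
      compose {x} (inj₁ (xy , inj₁ m≤x)) (inj₂ (z≡m′ , y≡m)) =
        inj₂ (z≡m′ , ℕP.≤-antisym (subst (L x ≤_) y≡m xy) m≤x)
      compose (inj₁ (xy , inj₂ y<m)) (inj₂ (_ , y≡m)) = ⊥-elim (ℕP.<-irrefl y≡m y<m)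
      compose (inj₂ (y≡m′ , x≡m)) (inj₁ (yz , inj₁ m≤y)) = ⊥-elim (ℕP.<-irrefl refl (subst (m ≤_) y≡m′ m≤y))
      compose {z = z} (inj₂ (y≡m′ , x≡m)) (inj₁ (yz , inj₂ z<m)) =
        inj₂ (ℕP.≤-antisym (ℕP.≤-pred z<m) (subst (_≤ L z) y≡m′ yz) , x≡m)
      compose (inj₂ (y≡m′ , _)) (inj₂ (_ , y≡m)) = ⊥-elim (ℕP.<-irrefl (trans (sym y≡m′) y≡m) (ℕP.n<1+n m′))

    merge-m : merge m ≡ merge m′
    merge-m = trans (merge-≥ ℕP.≤-refl) (sym (merge-< (ℕP.n<1+n m′)))

    twisted⊆merged : ∀ x y → Twisted x y → merge (L x) ≤ merge (L y)
    twisted⊆merged x y (inj₁ (x≤y , _))    = merge-mono x≤y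
    twisted⊆merged x y (inj₂ (y≡m′ , x≡m)) =
      ℕP.≤-reflexive (trans (cong merge x≡m) (trans merge-m (cong merge (sym y≡m′))))

    a : Fin n
    a = proj₁ (Composition.noGaps F i0 m′ (subst (m′ <_) (sym L-i0) (ℕP.n<1+n m′)))

    L-a : L a ≡ m′
    L-a = proj₂ (Composition.noGaps F i0 m′ (subst (m′ <_) (sym L-i0) (ℕP.n<1+n m′)))

    U : Subset n
    U x = does (L x ℕ.<? m)

    U-intro : ∀ {x} → L x < m → U x ≡ true
    U-intro {x} = dec-true (L x ℕ.<? m)

    U-intro¬ : ∀ {x} → ¬ L x < m → U x ≡ false
    U-intro¬ {x} = dec-false (L x ℕ.<? m)

    U-elim : ∀ {x} → U x ≡ true → L x < m
    U-elim {x} = from-does (L x ℕ.<? m)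

    U-elim¬ : ∀ {x} → U x ≡ false → ¬ L x < m
    U-elim¬ {x} = from-does¬ (L x ℕ.<? m)

    L-i0≮m : ¬ L i0 < m
    L-i0≮m i0<m = ℕP.<-irrefl L-i0 i0<m

    L-a<m : L a < m
    L-a<m = subst (_< m) (sym L-a) (ℕP.n<1+n m′)

    U-upset : IsUpset (toPreposet F) U
    U-upset x y Ux y≤x = U-intro (ℕP.≤-<-trans y≤x (U-elim Ux))

    U-proper : ProperNonempty U
    U-proper = (a , U-intro L-a<m) , (i0 , U-intro¬ L-i0≮m)

    ∁U-upset : IsUpset twisted (∁ U)
    ∁U-upset x y ∁Ux (inj₁ (_ , inj₁ m≤y)) = cong not (U-intro¬ (ℕP.≤⇒≯ m≤y))
    ∁U-upset x y ∁Ux (inj₁ (_ , inj₂ x<m)) = ⊥-elim (U-elim¬ (BoolP.not-injective ∁Ux) x<m)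
    ∁U-upset x y ∁Ux (inj₂ (_ , y≡m))      = cong not (U-intro¬ (λ y<m → ℕP.<-irrefl y≡m y<m))

    ∁U-proper : ProperNonempty (∁ U)
    ∁U-proper = (i0 , cong not (U-intro¬ L-i0≮m)) , (a , cong not (U-intro L-a<m))

    Meets : Subset n → ℕ → Set
    Meets V k = ∃ λ x → V x ≡ true × L x ≡ k

    Misses : Subset n → ℕ → Set
    Misses V k = ∃ λ y → V y ≡ false × L y ≡ k

    cutting-upset≗U : ∀ {V} → IsUpset (toPreposet F) V → Meets V m′ → Misses V m → ∀ z → V z ≡ U z
    cutting-upset≗U {V} V↑ (x , Vx , Lx) (y , Vy , Ly) z = by-cases (L z ℕ.<? m) (V z) refl
      where
      by-cases : Dec (L z < m) → ∀ b → V z ≡ b → V z ≡ U z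
      by-cases (yes z<m) _     _  = trans (V↑ x z Vx (subst (L z ≤_) (sym Lx) (ℕP.≤-pred z<m))) (sym (U-intro z<m))
      by-cases (no  z≮m) false Vz = trans Vz (sym (U-intro¬ z≮m))
      by-cases (no  z≮m) true  Vz =
        ⊥-elim (true≢false (trans (sym (V↑ z y Vz (subst (_≤ L z) (sym Ly) (ℕP.≮⇒≥ z≮m)))) Vy))

    F-upset⇒merged-upset : ∀ {V} → IsUpset (toPreposet F) V → ¬ (Meets V m′ × Misses V m) →
      IsUpset (toPreposet merged) V
    F-upset⇒merged-upset {V} V↑ not-cutting x y Vx my≤mx with L y ℕ.≤? L x
    ... | yes y≤x = V↑ x y Vx y≤x
    ... | no  y≰x with merge-collapse (ℕP.≰⇒> y≰x) my≤mx | V y in Vy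
    ...   | _ , _       | true  = refl
    ...   | Lx≡m′ , Ly≡m | false = ⊥-elim (not-cutting ((x , Vx , Lx≡m′) , (y , Vy , Ly≡m)))

    positive-F⇒ : ∀ {h} → Positive (toPreposet F) h → Positive (toPreposet merged) h × 0ℚ <ℚ subsetSum U h
    positive-F⇒ pos =
      positive-mono {p = toPreposet merged} {toPreposet F} (λ x y → merge-mono) pos , pos U U-proper U-upset

    positive-F⇐ : ∀ {h} → Positive (toPreposet merged) h → 0ℚ <ℚ subsetSum U h → Positive (toPreposet F) h
    positive-F⇐ {h} pos 0<U V proper V↑ with lem {Meets V m′ × Misses V m}
    ... | yes (meets , misses) =
      subst (0ℚ <ℚ_) (subsetSum-cong h (λ z → sym (cutting-upset≗U V↑ meets misses z))) 0<U
    ... | no  not-cutting      = pos V proper (F-upset⇒merged-upset V↑ not-cutting)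

    positive-twisted⇒ : ∀ {h} → InT h → Positive twisted h →
      Positive (toPreposet merged) h × ¬ (0ℚ <ℚ subsetSum U h)
    positive-twisted⇒ {h} sum0 pos =
      positive-mono {p = toPreposet merged} {twisted} twisted⊆merged pos ,
      λ 0<U → ℚP.<-irrefl (sym (trans (subsetSum-∁ U h) sum0))
                          (pos+nonneg 0<U (ℚP.<⇒≤ (pos (∁ U) ∁U-proper ∁U-upset)))

    twisted-upset⇒merged-upset : ∀ {V} → IsUpset twisted V → Meets V m′ → IsUpset (toPreposet merged) V
    twisted-upset⇒merged-upset {V} V↑ (x₀ , Vx₀ , Lx₀) x y Vx my≤mx with L y ℕ.≤? L x
    ... | no  y≰x = V↑ x y Vx (inj₂ (merge-collapse (ℕP.≰⇒> y≰x) my≤mx))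
    ... | yes y≤x with L x ℕ.<? m | L y ℕ.<? m
    ...   | yes x<m | _       = V↑ x y Vx (inj₁ (y≤x , inj₂ x<m))
    ...   | no  _   | no  y≮m = V↑ x y Vx (inj₁ (y≤x , inj₁ (ℕP.≮⇒≥ y≮m)))
    ...   | no  _   | yes y<m =
      V↑ x₀ y Vx₀ (inj₁ (subst (L y ≤_) (sym Lx₀) (ℕP.≤-pred y<m) , inj₂ (subst (_< m) (sym Lx₀) (ℕP.n<1+n m′))))

    inner-upset : ∀ {V} → IsUpset twisted V → ¬ Meets V m′ → IsUpset (toPreposet merged) (V ∩ U)
    inner-upset {V} V↑ avoids x y x∈ my≤mx with ∩-elim V U x∈
    ... | Vx , Ux with m ℕ.≤? L y
    ...   | no m≰y = ∩-intro V U (V↑ x y Vx (inj₁ (y≤x , inj₂ x<m))) (U-intro y<m)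
      where
      y<m : L y < m
      y<m = ℕP.≰⇒> m≰y
      x<m : L x < m
      x<m = U-elim Ux
      y≤x : L y ≤ L x
      y≤x = subst₂ _≤_ (merge-< y<m) (merge-< x<m) my≤mx
    ...   | yes m≤y =
      ⊥-elim (ℕP.<-irrefl refl (ℕP.<-≤-trans x<m′ (ℕP.≤-trans m′≤my (subst (merge (L y) ≤_) (merge-< (U-elim Ux)) my≤mx))))
      where
      x<m′ : L x < m′
      x<m′ = ℕP.≤∧≢⇒< (ℕP.≤-pred (U-elim Ux)) (λ Lx≡m′ → avoids (x , Vx , Lx≡m′))
      m′≤my : m′ ≤ merge (L y)
      m′≤my = subst (m′ ≤_) (sym (merge-≥ m≤y)) (ℕP.pred-mono-≤ m≤y)

    outer-upset : ∀ {V z} → IsUpset twisted V → V z ≡ true → ¬ L z < m →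
      IsUpset (toPreposet merged) ((V ∩ ∁ U) ∪ U)
    outer-upset {V} {z} V↑ Vz z≮m x y x∈ my≤mx with m ℕ.≤? L y
    ... | no  m≰y = ∪-intro (V ∩ ∁ U) U (inj₂ (U-intro (ℕP.≰⇒> m≰y)))
    ... | yes m≤y = ∪-intro (V ∩ ∁ U) U (inj₁ (∩-intro V (∁ U) Vy (cong not (U-intro¬ (ℕP.≤⇒≯ m≤y)))))
      where
      Vy : V y ≡ true
      Vy with ∪-elim (V ∩ ∁ U) U x∈
      ... | inj₂ Ux = V↑ z y Vz (inj₁ (subst (_≤ L z) (sym Ly≡m) (ℕP.≮⇒≥ z≮m) , inj₁ m≤y))
        where
        Ly≡m : L y ≡ m
        Ly≡m = proj₂ (merge-collapse (ℕP.<-≤-trans (U-elim Ux) m≤y) my≤mx)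
      ... | inj₁ x∈V∖U with ∩-elim V (∁ U) x∈V∖U
      ...   | Vx , ∁Ux = V↑ x y Vx (inj₁ (pred-cancel m≤y m≤x (subst₂ _≤_ (merge-≥ m≤y) (merge-≥ m≤x) my≤mx) , inj₁ m≤y))
        where
        m≤x : m ≤ L x
        m≤x = ℕP.≮⇒≥ (U-elim¬ (BoolP.not-injective ∁Ux))

    -- when U is negative, an upset of twisted avoiding lump m′ splits into its
    -- parts inside and outside U, and the outer part gains the positive mass of ∁ U
    positive-twisted⇐ : ∀ {h} → Generic h → Positive (toPreposet merged) h → ¬ (0ℚ <ℚ subsetSum U h) →
      Positive twisted h
    positive-twisted⇐ {h} gen pos U≯0 V proper V↑ with lem {Meets V m′}
    ... | yes meets = pos V proper (twisted-upset⇒merged-upset V↑ meets)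
    ... | no  avoids = subst (0ℚ <ℚ_) (subsetSum-∩∁ V U h) (by-cases (proj₁ proper))
      where
      nonneg : UpsetsNonneg (toPreposet merged) h
      nonneg = positive⇒upsets-nonneg lem (toPreposet merged) (proj₁ gen) pos
      U<0 : subsetSum U h <ℚ 0ℚ
      U<0 = ≮∧≢⇒> U≯0 (λ e → proj₂ gen U U-proper (sym e))
      0<∁U : 0ℚ <ℚ subsetSum (∁ U) h
      0<∁U = sum≡0∧neg⇒pos (trans (subsetSum-∁ U h) (proj₁ gen)) U<0
      outer-positive : ∀ {z} → V z ≡ true → ¬ L z < m → 0ℚ <ℚ subsetSum (V ∩ ∁ U) h
      outer-positive Vz z≮m = subst (0ℚ <ℚ_) outer-mass (nonneg+pos (nonneg _ (outer-upset V↑ Vz z≮m)) 0<∁U)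
        where
        Z : Subset n
        Z = (V ∩ ∁ U) ∪ U
        outer-mass : subsetSum Z h +ℚ subsetSum (∁ U) h ≡ subsetSum (V ∩ ∁ U) h
        outer-mass = trans (subsetSum-∩∪ Z (∁ U) h)
                           (trans (cong₂ _+ℚ_ (subsetSum-cong h meet) (trans (subsetSum-full h join) (proj₁ gen)))
                                  (ℚP.+-identityʳ _))
          where
          meet : ∀ k → (Z ∩ ∁ U) k ≡ (V ∩ ∁ U) k
          meet k with V k | U k
          ... | true  | true  = refl
          ... | true  | false = refl
          ... | false | true  = refl
          ... | false | false = refl
          join : ∀ k → (Z ∪ ∁ U) k ≡ true
          join k with V k | U k
          ... | true  | true  = refl
          ... | true  | false = refl
          ... | false | true  = refl
          ... | false | false = refl
      outer-nonneg : 0ℚ ≤ℚ subsetSum (V ∩ ∁ U) h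
      outer-nonneg with lem {∃ λ z → V z ≡ true × ¬ L z < m}
      ... | yes (z , Vz , z≮m) = ℚP.<⇒≤ (outer-positive Vz z≮m)
      ... | no  none = ℚP.≤-reflexive (sym (subsetSum-∅ h empty))
        where
        empty : ∀ z → (V ∩ ∁ U) z ≡ false
        empty z with V z in Vz | L z ℕ.<? m
        ... | false | _       = refl
        ... | true  | yes z<m = cong not (U-intro z<m)
        ... | true  | no  z≮m = ⊥-elim (none (z , Vz , z≮m))
      by-cases : (∃ λ v → V v ≡ true) → 0ℚ <ℚ subsetSum (V ∩ U) h +ℚ subsetSum (V ∩ ∁ U) h
      by-cases (v , Vv) with L v ℕ.<? m
      ... | yes v<m = pos+nonneg (pos (V ∩ U) inner-proper (inner-upset V↑ avoids)) outer-nonneg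
        where
        inner-proper : ProperNonempty (V ∩ U)
        inner-proper = (v , ∩-intro V U Vv (U-intro v<m)) ,
                       (i0 , trans (cong (V i0 ∧_) (U-intro¬ L-i0≮m)) (BoolP.∧-zeroʳ (V i0)))
      ... | no  v≮m = nonneg+pos (nonneg _ (inner-upset V↑ avoids)) (outer-positive Vv v≮m)

module Spanning where

  open Counting
  open Classical
  open Cones
  open Indicators
  open Extensions
  open Compositions
  open import Level using (0ℓ; _⊔_)
  open import Axiom.ExcludedMiddle using (ExcludedMiddle)
  open import Data.Nat as ℕ using (ℕ; zero; suc; _<_; _≤_)
  import Data.Nat.Properties as ℕP
  open import Data.Nat.Induction using (<-wellFounded)
  open import Data.Bool using (true)
  open import Induction.WellFounded using (Acc; acc)
  open import Data.Fin using (Fin)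
  open import Data.Product using (Σ; ∃; _×_; _,_; proj₁)
  open import Data.Product.Relation.Binary.Lex.Strict using (×-Lex; ×-wellFounded)
  open import Data.Sum using (_⊎_; inj₁; inj₂)
  open import Data.Empty using (⊥-elim)
  open import Data.List using (List; []; _∷_; _++_; map)
  open import Data.List.Relation.Unary.All using (All; []; _∷_)
  import Data.List.Relation.Unary.All.Properties as AllP
  open import Relation.Nullary using (¬_; yes; no)
  import Relation.Binary.PropositionalEquality as ≡
  open import Data.Rational using (ℚ; 0ℚ) renaming (_<_ to _<ℚ_)
  import Algebra.Properties.Ring as RingProperties

  module _ {c ℓ} (K : CharZeroField c ℓ) (lem : ExcludedMiddle 0ℓ) {n} (i0 : Fin n) where
    open CharZeroField K hiding (zero)
    open RingProperties ring using (-0#≈0#; -‿+-comm; -‿distribˡ-*)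

    Combination : Set c
    Combination = List (Composition n × Carrier)

    InΣ : Combination → Set c
    InΣ = All (λ Fa → FirstLumpContains i0 (proj₁ Fa))

    InSpan : ((Fin n → ℚ) → Carrier) → Set (c ⊔ ℓ)
    InSpan φ = Σ Combination λ L → InΣ L × (∀ h → Generic h → φ h ≈ combo K lem L h)

    combo-++ : ∀ (L L′ : Combination) h → combo K lem (L ++ L′) h ≈ combo K lem L h + combo K lem L′ h
    combo-++ []       L′ h = sym (+-identityˡ _)
    combo-++ (_ ∷ L) L′ h = trans (+-cong refl (combo-++ L L′ h)) (sym (+-assoc _ _ _))

    negate : Combination → Combination
    negate = map (λ (F , a) → F , - a)

    combo-negate : ∀ (L : Combination) h → combo K lem (negate L) h ≈ - combo K lem L h
    combo-negate []            h = sym -0#≈0#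
    combo-negate ((F , a) ∷ L) h = trans (+-cong (sym (-‿distribˡ-* a _)) (combo-negate L h)) (-‿+-comm _ _)

    InSpan-cong : ∀ {φ ψ} → (∀ h → Generic h → φ h ≈ ψ h) → InSpan ψ → InSpan φ
    InSpan-cong φ≈ψ (L , L∈Σ , ψ≈) = L , L∈Σ , λ h gen → trans (φ≈ψ h gen) (ψ≈ h gen)

    InSpan-+ : ∀ {φ ψ} → InSpan φ → InSpan ψ → InSpan (λ h → φ h + ψ h)
    InSpan-+ (L , L∈Σ , φ≈) (L′ , L′∈Σ , ψ≈) =
      L ++ L′ , AllP.++⁺ L∈Σ L′∈Σ ,
      λ h gen → trans (+-cong (φ≈ h gen) (ψ≈ h gen)) (sym (combo-++ L L′ h))

    InSpan-neg : ∀ {φ} → InSpan φ → InSpan (λ h → - φ h)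
    InSpan-neg (L , L∈Σ , φ≈) =
      negate L , AllP.map⁺ L∈Σ , λ h gen → trans (-‿cong (φ≈ h gen)) (sym (combo-negate L h))

    Spanned : Preposet n → Set (c ⊔ ℓ)
    Spanned p = InSpan (λ h → 𝟙 K lem (Positive p h))

    spanned-basis : ∀ F → FirstLumpContains i0 F → Spanned (toPreposet F)
    spanned-basis F F∈Σ = (F , 1#) ∷ [] , F∈Σ ∷ [] ,
      λ h gen → sym (trans (+-identityʳ _) (trans (*-identityˡ _) (reflexive (č≡𝟙 K lem (toPreposet F) gen))))

    𝟙-incomparable : ∀ (p : Preposet n) x y {h} → Generic h →
      𝟙 K lem (Positive p h) ≈ (𝟙 K lem (Positive (extend p x y) h) + 𝟙 K lem (Positive (extend p y x) h))
                                + - 𝟙 K lem (Positive (identify p x y) h)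
    𝟙-incomparable p x y {h} gen =
      x+y≈z⇒x≈z-y K lem (trans (+-cong (reflexive both) (reflexive either)) (𝟙-×⊎ K lem))
      where
      P₁ P₂ : Set
      P₁ = Positive (extend p x y) h
      P₂ = Positive (extend p y x) h
      both : 𝟙 K lem (Positive p h) ≡.≡ 𝟙 K lem (P₁ × P₂)
      both = 𝟙-cong K lem (λ pos → positive-extend p x y pos , positive-extend p y x pos)
                          (λ (pos₁ , pos₂) → positive-extend⁻ p x y pos₁ pos₂)
      either : 𝟙 K lem (Positive (identify p x y) h) ≡.≡ 𝟙 K lem (P₁ ⊎ P₂)
      either = 𝟙-cong K lem (positive-identify⁻ lem p x y gen) (positive-identify p x y)

    module _ (F : Composition n) (m′ : ℕ) (L-i0 : Composition.lump F i0 ≡.≡ suc m′) where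
      open Merge lem F i0 m′ L-i0

      𝟙-merge : ∀ {h} → Generic h →
        𝟙 K lem (Positive (toPreposet F) h)
          ≈ 𝟙 K lem (Positive (toPreposet merged) h) + - 𝟙 K lem (Positive twisted h)
      𝟙-merge {h} gen = x+y≈z⇒x≈z-y K lem (trans (+-cong (reflexive on-F) (reflexive on-twisted)) (𝟙-split K lem))
        where
        U-positive : Set
        U-positive = 0ℚ <ℚ subsetSum U h
        on-F : 𝟙 K lem (Positive (toPreposet F) h) ≡.≡ 𝟙 K lem (Positive (toPreposet merged) h × U-positive)
        on-F = 𝟙-cong K lem positive-F⇒ (λ (pos , 0<U) → positive-F⇐ pos 0<U)
        on-twisted : 𝟙 K lem (Positive twisted h) ≡.≡ 𝟙 K lem (Positive (toPreposet merged) h × ¬ U-positive)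
        on-twisted =
          𝟙-cong K lem (positive-twisted⇒ (proj₁ gen)) (λ (pos , U≯0) → positive-twisted⇐ gen pos U≯0)

    Refines : Preposet n → Preposet n → Set
    Refines q q′ = ∀ x y → Preposet.rel q x y → Preposet.rel q′ x y

    μ : Preposet n → ℕ
    μ q = count (λ z → holds lem (¬ Preposet.rel q i0 z))

    ν : Preposet n → ℕ
    ν q = sumℕ (λ x → count (λ y → holds lem (¬ Preposet.rel q x y)))

    unrelated-anti : ∀ {q q′ : Preposet n} {x} → (∀ y → Preposet.rel q x y → Preposet.rel q′ x y) →
      ∀ y → holds lem (¬ Preposet.rel q′ x y) ≡.≡ true → holds lem (¬ Preposet.rel q x y) ≡.≡ true
    unrelated-anti q⊆q′ y e = holds-intro lem (λ r → holds-elim lem e (q⊆q′ y r))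

    μ-mono : ∀ {q q′} → Refines q q′ → μ q′ ≤ μ q
    μ-mono {q} {q′} q⊆q′ = count-mono (unrelated-anti {q} {q′} (q⊆q′ i0))

    μ-strict : ∀ {q q′ : Preposet n} → (∀ z → Preposet.rel q i0 z → Preposet.rel q′ i0 z) →
      ∀ w → ¬ Preposet.rel q i0 w → Preposet.rel q′ i0 w → μ q′ < μ q
    μ-strict {q} {q′} q⊆q′ w ¬r r′ =
      count-strict (unrelated-anti {q} {q′} q⊆q′) w (holds-intro¬ lem (λ ¬r′ → ¬r′ r′)) (holds-intro lem ¬r)

    ν-strict : ∀ {q q′} → Refines q q′ → ∀ x y → ¬ Preposet.rel q x y → Preposet.rel q′ x y → ν q′ < ν q
    ν-strict {q} {q′} q⊆q′ x y ¬r r′ =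
      sumℕ-strict (λ a → count-mono (unrelated-anti {q} {q′} (q⊆q′ a))) x
        (count-strict (unrelated-anti {q} {q′} (q⊆q′ x)) y (holds-intro¬ lem (λ ¬r′ → ¬r′ r′)) (holds-intro lem ¬r))

    spanned-merge : ∀ F m′ (L-i0 : Composition.lump F i0 ≡.≡ suc m′) →
      (∀ q → μ q < μ (toPreposet F) → Spanned q) → Spanned (toPreposet F)
    spanned-merge F m′ L-i0 IH =
      InSpan-cong (λ h gen → 𝟙-merge F m′ L-i0 gen)
                  (InSpan-+ (IH (toPreposet merged) μ-merged) (InSpan-neg (IH twisted μ-twisted)))
      where
      open Merge lem F i0 m′ L-i0
      a≰i0 : ¬ L i0 ≤ L a
      a≰i0 i0≤a = ℕP.<-irrefl ≡.refl (ℕP.<-≤-trans L-a<m (≡.subst (_≤ L a) L-i0 i0≤a))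
      μ-merged : μ (toPreposet merged) < μ (toPreposet F)
      μ-merged = μ-strict {toPreposet F} {toPreposet merged} (λ z → merge-mono) a a≰i0
                   (ℕP.≤-reflexive (≡.trans (≡.cong merge L-i0) (≡.trans merge-m (≡.cong merge (≡.sym L-a)))))
      μ-twisted : μ twisted < μ (toPreposet F)
      μ-twisted = μ-strict {toPreposet F} {twisted} (λ z i0≤z → inj₁ (i0≤z , inj₁ (ℕP.≤-reflexive (≡.sym L-i0))))
                           a a≰i0 (inj₂ (L-a , L-i0))

    spanned-composition : ∀ F → (∀ q → μ q < μ (toPreposet F) → Spanned q) → Spanned (toPreposet F)
    spanned-composition F = by-lump (Composition.lump F i0) ≡.refl
      where
      by-lump : ∀ k → Composition.lump F i0 ≡.≡ k →
        (∀ q → μ q < μ (toPreposet F) → Spanned q) → Spanned (toPreposet F)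
      by-lump zero     L-i0 _  = spanned-basis F L-i0
      by-lump (suc m′) L-i0 IH = spanned-merge F m′ L-i0 IH

    _<ₗₑₓ_ : ℕ × ℕ → ℕ × ℕ → Set
    _<ₗₑₓ_ = ×-Lex ≡._≡_ ℕ._<_ ℕ._<_

    ≤×<⇒<ₗₑₓ : ∀ {a a′ b b′} → a′ ≤ a → b′ < b → (a′ , b′) <ₗₑₓ (a , b)
    ≤×<⇒<ₗₑₓ a′≤a b′<b with ℕP.m≤n⇒m<n∨m≡n a′≤a
    ... | inj₁ a′<a = inj₁ a′<a
    ... | inj₂ a′≡a = inj₂ (a′≡a , b′<b)

    -- a preposet without incomparable pairs is a composition
    spanned-acc : ∀ q → Acc _<ₗₑₓ_ (μ q , ν q) → Spanned q
    spanned-acc q (acc smaller) with lem {∃ λ x → ∃ λ y → ¬ rel x y × ¬ rel y x}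
      where open Preposet q using (rel)
    ... | yes (x , y , x≱y , y≱x) =
      InSpan-cong (λ h gen → 𝟙-incomparable q x y gen)
        (InSpan-+ (InSpan-+ (refinement (extend q x y) (λ _ _ → inj₁) x y x≱y (inj₂ (rel-refl x , rel-refl y)))
                            (refinement (extend q y x) (λ _ _ → inj₁) y x y≱x (inj₂ (rel-refl y , rel-refl x))))
                  (InSpan-neg (refinement (identify q x y) (λ _ _ → inj₁) x y x≱y (inj₂ (inj₁ (rel-refl x , rel-refl y))))))
      where
      open Preposet q using (rel) renaming (refl to rel-refl)
      refinement : ∀ q′ → Refines q q′ → ∀ a b → ¬ rel a b → Preposet.rel q′ a b → Spanned q′
      refinement q′ q⊆q′ a b ¬r r′ =
        spanned-acc q′ (smaller (≤×<⇒<ₗₑₓ (μ-mono {q} {q′} q⊆q′) (ν-strict {q} {q′} q⊆q′ a b ¬r r′)))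
    ... | no none =
      InSpan-cong (λ h gen → reflexive (𝟙-cong K lem (positive-mono {p = toPreposet F} {q} q⊆F)
                                                     (positive-mono {p = q} {toPreposet F} F⊆q)))
        (spanned-composition F λ q′ μq′<μF → spanned-acc q′ (smaller (inj₁ (≡.subst (μ q′ <_) μF≡μq μq′<μF))))
      where
      open Preposet q using (rel)
      total : ∀ x y → rel x y ⊎ rel y x
      total x y with lem {rel x y} | lem {rel y x}
      ... | yes x≥y | _       = inj₁ x≥y
      ... | no  _   | yes y≥x = inj₂ y≥x
      ... | no  x≱y | no  y≱x = ⊥-elim (none (x , y , x≱y , y≱x))
      open FromTotal lem q total using (toComposition; rel⇒lump≤; lump≤⇒rel)
      F : Composition n
      F = toComposition
      F⊆q : Refines (toPreposet F) q
      F⊆q x y = lump≤⇒rel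
      q⊆F : Refines q (toPreposet F)
      q⊆F x y = rel⇒lump≤
      μF≡μq : μ (toPreposet F) ≡.≡ μ q
      μF≡μq = ℕP.≤-antisym (μ-mono {q} {toPreposet F} q⊆F) (μ-mono {toPreposet F} {q} F⊆q)

    spanned : ∀ q → Spanned q
    spanned q = spanned-acc q (×-wellFounded <-wellFounded <-wellFounded (μ q , ν q))

    č-spanned : ∀ p → ∃ λ L → InΣ L × (∀ h → Generic h → č K lem p h ≈ combo K lem L h)
    č-spanned p = InSpan-cong (λ h gen → reflexive (č≡𝟙 K lem p gen)) (spanned p)

module Expansion where

  open import Data.Nat as ℕ using (ℕ; zero; suc)
  open import Data.List using (List; []; _∷_; length)
  open import Data.List.Relation.Unary.All using (All; []; _∷_)
  open import Data.List.Relation.Unary.First using (First; [_]; _∷_)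
  open import Data.Product using (_×_; _,_; proj₁; proj₂)
  open import Data.Sum using (_⊎_; inj₁; inj₂)
  open import Data.Empty using (⊥-elim)
  open import Relation.Binary.PropositionalEquality
  open import Data.Rational using (ℚ; 0ℚ; 1ℚ; _+_; _*_; -_; _≤_; _<_)
  import Data.Rational.Properties as ℚP
  open import Data.Rational.Solver using (module +-*-Solver)
  open +-*-Solver

  pow2 : ℕ → ℚ
  pow2 zero    = 1ℚ
  pow2 (suc d) = pow2 d + pow2 d

  0<pow2 : ∀ d → 0ℚ < pow2 d
  0<pow2 zero    = ℚP.positive⁻¹ 1ℚ
  0<pow2 (suc d) = subst (_< pow2 d + pow2 d) (ℚP.+-identityʳ 0ℚ) (ℚP.+-mono-< (0<pow2 d) (0<pow2 d))

  expand : List ℚ → ℚ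
  expand []       = 0ℚ
  expand (c ∷ cs) = pow2 (length cs) * c + expand cs

  Trit : ℚ → Set
  Trit q = q ≡ 0ℚ ⊎ q ≡ 1ℚ ⊎ q ≡ - 1ℚ

  trit-bounds : ∀ w q → 0ℚ ≤ w → Trit q → (- w ≤ w * q) × (w * q ≤ w)
  trit-bounds w q 0≤w (inj₁ refl) =
    subst (- w ≤_) (sym (ℚP.*-zeroʳ w)) (ℚP.neg-antimono-≤ 0≤w) , subst (_≤ w) (sym (ℚP.*-zeroʳ w)) 0≤w
  trit-bounds w q 0≤w (inj₂ (inj₁ refl)) =
    subst (- w ≤_) (sym (ℚP.*-identityʳ w)) (ℚP.≤-trans (ℚP.neg-antimono-≤ 0≤w) 0≤w) , ℚP.≤-reflexive (ℚP.*-identityʳ w)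
  trit-bounds w q 0≤w (inj₂ (inj₂ refl)) =
    ℚP.≤-reflexive (times-neg-one w) , subst (_≤ w) (times-neg-one w) (ℚP.≤-trans (ℚP.neg-antimono-≤ 0≤w) 0≤w)
    where
    times-neg-one : ∀ w → - w ≡ w * - 1ℚ
    times-neg-one = solve 1 (λ w → :- w := w :* (:- con 1ℚ)) refl

  expand-bounds : ∀ {cs} → All Trit cs → (- pow2 (length cs) < expand cs) × (expand cs < pow2 (length cs))
  expand-bounds [] = ℚP.neg-antimono-< (ℚP.positive⁻¹ 1ℚ) , ℚP.positive⁻¹ 1ℚ
  expand-bounds {c ∷ cs} (t ∷ ts) with expand-bounds ts | trit-bounds (pow2 (length cs)) c (ℚP.<⇒≤ (0<pow2 (length cs))) t
  ... | lo , hi | tlo , thi =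
    subst (_< pow2 (length cs) * c + expand cs) (sym (ℚP.neg-distrib-+ (pow2 (length cs)) _)) (ℚP.+-mono-≤-< tlo lo) ,
    ℚP.+-mono-≤-< thi hi

  expand-0∷ : ∀ cs → expand (0ℚ ∷ cs) ≡ expand cs
  expand-0∷ cs = trans (cong (_+ expand cs) (ℚP.*-zeroʳ (pow2 (length cs)))) (ℚP.+-identityˡ (expand cs))

  expand-pos : ∀ {cs} → All Trit cs → First (_≡ 0ℚ) (_≡ 1ℚ) cs → 0ℚ < expand cs
  expand-pos {c ∷ cs} (_ ∷ ts) [ refl ] =
    subst₂ _<_ (ℚP.+-inverseʳ (pow2 (length cs))) (cong (_+ expand cs) (sym (ℚP.*-identityʳ (pow2 (length cs)))))
           (ℚP.+-monoʳ-< (pow2 (length cs)) (proj₁ (expand-bounds ts)))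
  expand-pos {c ∷ cs} (_ ∷ ts) (refl ∷ first) = subst (0ℚ <_) (sym (expand-0∷ cs)) (expand-pos ts first)

  expand-neg : ∀ {cs} → All Trit cs → First (_≡ 0ℚ) (_≡ - 1ℚ) cs → expand cs < 0ℚ
  expand-neg {c ∷ cs} (_ ∷ ts) [ refl ] =
    subst₂ _<_ (cong (_+ expand cs) (times-neg-one (pow2 (length cs)))) (ℚP.+-inverseˡ (pow2 (length cs)))
           (ℚP.+-monoʳ-< (- pow2 (length cs)) (proj₂ (expand-bounds ts)))
    where
    times-neg-one : ∀ w → - w ≡ w * - 1ℚ
    times-neg-one = solve 1 (λ w → :- w := w :* (:- con 1ℚ)) refl
  expand-neg {c ∷ cs} (_ ∷ ts) (refl ∷ first) = subst (_< 0ℚ) (sym (expand-0∷ cs)) (expand-neg ts first)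

  leading-sign : ∀ {cs} → All Trit cs → First (_≡ 0ℚ) (_≢ 0ℚ) cs →
    First (_≡ 0ℚ) (_≡ 1ℚ) cs ⊎ First (_≡ 0ℚ) (_≡ - 1ℚ) cs
  leading-sign (inj₁ c≡0 ∷ _)         [ c≢0 ]       = ⊥-elim (c≢0 c≡0)
  leading-sign (inj₂ (inj₁ c≡1) ∷ _)  [ _ ]         = inj₁ [ c≡1 ]
  leading-sign (inj₂ (inj₂ c≡-1) ∷ _) [ _ ]         = inj₂ [ c≡-1 ]
  leading-sign (_ ∷ ts)               (c≡0 ∷ first) with leading-sign ts first
  ... | inj₁ pos = inj₁ (c≡0 ∷ pos)
  ... | inj₂ neg = inj₂ (c≡0 ∷ neg)

  expand≢0 : ∀ {cs} → All Trit cs → First (_≡ 0ℚ) (_≢ 0ℚ) cs → expand cs ≢ 0ℚ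
  expand≢0 ts first e with leading-sign ts first
  ... | inj₁ pos = ℚP.<-irrefl (sym e) (expand-pos ts pos)
  ... | inj₂ neg = ℚP.<-irrefl e (expand-neg ts neg)

  expand-zeros : ∀ {cs} → All (_≡ 0ℚ) cs → expand cs ≡ 0ℚ
  expand-zeros []                  = refl
  expand-zeros {_ ∷ cs} (refl ∷ zs) = trans (expand-0∷ cs) (expand-zeros zs)

module TestPoints where

  open Sums
  open Counting
  open Classical
  open Expansion
  open Indicators using (signAt)
  open import Level using (0ℓ)
  open import Axiom.ExcludedMiddle using (ExcludedMiddle)
  open import Data.Nat as ℕ using (ℕ; zero; suc; z≤n; s≤s) renaming (_<_ to _<ℕ_; _≤_ to _≤ℕ_)
  import Data.Nat.Properties as ℕP
  open import Data.Fin using (Fin)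
  open import Data.Bool using (Bool; true; false; if_then_else_) renaming (_≟_ to _≟ᵇ_)
  open import Data.Product using (∃; _×_; _,_; proj₁; proj₂)
  open import Data.Sum using (inj₁; inj₂)
  open import Data.Empty using (⊥; ⊥-elim)
  open import Data.List using (List; []; _∷_; _++_; map; length; tabulate; applyUpTo)
  import Data.List.Properties as ListP
  open import Data.List.Relation.Unary.All using (All; []; _∷_)
  import Data.List.Relation.Unary.All.Properties as AllP
  open import Data.List.Relation.Unary.First using (First; [_]; _∷_)
  import Data.List.Relation.Unary.First.Properties as FirstP
  open import Relation.Nullary using (¬_; yes; no; does)
  open import Relation.Nullary.Decidable using (dec-true; dec-false)
  open import Relation.Binary.PropositionalEquality
  open import Data.Rational using (ℚ; 0ℚ; 1ℚ; _+_; _*_; -_; _-_; _≤_; _<_)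
  import Data.Rational.Properties as ℚP

  subsetSum-expand : ∀ {n} (V : Subset n) (vs : List (Fin n → ℚ)) →
    subsetSum V (λ x → expand (map (λ v → v x) vs)) ≡ expand (map (subsetSum V) vs)
  subsetSum-expand V []       = subsetSum-0 V
  subsetSum-expand V (v ∷ vs) = begin
    subsetSum V (λ x → pow2 (length (map (λ v → v x) vs)) * v x + expand (map (λ v → v x) vs))
      ≡⟨ subsetSum-congʳ V (λ x → cong (λ l → pow2 l * v x + expand (map (λ v → v x) vs))
                                       (ListP.length-map (λ v → v x) vs)) ⟩
    subsetSum V (λ x → pow2 (length vs) * v x + expand (map (λ v → v x) vs))
      ≡⟨ subsetSum-+ V _ _ ⟩
    subsetSum V (λ x → pow2 (length vs) * v x) + subsetSum V (λ x → expand (map (λ v → v x) vs))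
      ≡⟨ cong₂ _+_ (subsetSum-* V (pow2 (length vs)) v) (subsetSum-expand V vs) ⟩
    pow2 (length vs) * subsetSum V v + expand (map (subsetSum V) vs)
      ≡⟨ cong (λ l → pow2 l * subsetSum V v + expand (map (subsetSum V) vs))
              (sym (ListP.length-map (subsetSum V) vs)) ⟩
    expand (map (subsetSum V) (v ∷ vs)) ∎
    where
    open ≡-Reasoning

  first-change : ∀ (P : ℕ → Bool) w → P 0 ≡ true → P w ≡ false →
    ∃ λ t → t <ℕ w × (∀ t′ → t′ ≤ℕ t → P t′ ≡ true) × P (suc t) ≡ false
  first-change P zero    P0 Pw with () ← trans (sym P0) Pw
  first-change P (suc w) P0 Pw with P 1 in P1
  ... | false = 0 , s≤s z≤n , (λ { zero _ → P0 }) , P1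
  ... | true with first-change (λ t → P (suc t)) w P1 Pw
  ...   | t , t<w , before , after =
    suc t , s≤s t<w , (λ { zero _ → P0 ; (suc t′) (s≤s t′≤t) → before t′ t′≤t }) , after

  first-applyUpTo : ∀ {A : Set} {P Q : A → Set} (f : ℕ → A) {k t} → t <ℕ k →
    (∀ t′ → t′ <ℕ t → P (f t′)) → Q (f t) → First P Q (applyUpTo f k)
  first-applyUpTo f {suc k} {zero}  _         before at = [ at ]
  first-applyUpTo f {suc k} {suc t} (s≤s t<k) before at =
    before 0 (s≤s z≤n) ∷
    first-applyUpTo (λ t′ → f (suc t′)) t<k (λ t′ t′<t → before (suc t′) (s≤s t′<t)) at

  bit : Bool → ℚ
  bit b = if b then 1ℚ else 0ℚ

  sign : Bool → ℚ
  sign b = if b then 1ℚ else - 1ℚ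

  trit-bit- : ∀ a b → Trit (bit a - bit b)
  trit-bit- true  true  = inj₁ refl
  trit-bit- true  false = inj₂ (inj₁ refl)
  trit-bit- false true  = inj₂ (inj₂ refl)
  trit-bit- false false = inj₁ refl

  trit-sign* : ∀ s a b → Trit (sign s * (bit a - bit b))
  trit-sign* true  true  true  = inj₁ refl
  trit-sign* true  true  false = inj₂ (inj₁ refl)
  trit-sign* true  false true  = inj₂ (inj₂ refl)
  trit-sign* true  false false = inj₁ refl
  trit-sign* false true  true  = inj₁ refl
  trit-sign* false true  false = inj₂ (inj₂ refl)
  trit-sign* false false true  = inj₂ (inj₁ refl)
  trit-sign* false false false = inj₁ refl

  bit-≢ : ∀ {a b} → a ≢ b → bit a - bit b ≢ 0ℚ
  bit-≢ {true}  {true}  a≢b _ = a≢b refl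
  bit-≢ {false} {false} a≢b _ = a≢b refl
  bit-≢ {true}  {false} a≢b ()
  bit-≢ {false} {true}  a≢b ()

  sign*bit-≢ : ∀ s {a b} → a ≢ b → sign s * (bit a - bit b) ≢ 0ℚ
  sign*bit-≢ true  {true}  {true}  a≢b _ = a≢b refl
  sign*bit-≢ true  {false} {false} a≢b _ = a≢b refl
  sign*bit-≢ false {true}  {true}  a≢b _ = a≢b refl
  sign*bit-≢ false {false} {false} a≢b _ = a≢b refl
  sign*bit-≢ true  {true}  {false} a≢b ()
  sign*bit-≢ true  {false} {true}  a≢b ()
  sign*bit-≢ false {true}  {false} a≢b ()
  sign*bit-≢ false {false} {true}  a≢b ()

  bit-≡ : ∀ {a b} → a ≡ b → bit a - bit b ≡ 0ℚ
  bit-≡ {true}  refl = refl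
  bit-≡ {false} refl = refl

  -- The test point for a sign vector s is a binary expansion with vector digits:
  -- first e_y - e_(r (lump y)) for every y, where r t is a chosen element of
  -- lump t, then ± (e_(r t) - e_(r (t + 1))) with the sign s_t. The high digits
  -- decide the sign of every subset that is not a union of lumps; a union of
  -- lumps containing lump 0 gets the sign s_t of the first lump t + 1 it leaves out.
  module ForComposition (lem : ExcludedMiddle 0ℓ) {n} (F : Composition n) (i0 : Fin n)
                        (F-i0 : Composition.lump F i0 ≡ 0) where

    L : Fin n → ℕ
    L = Composition.lump F

    last : ∃ λ x → ∀ y → L y ≤ℕ L x
    last = let (x , _ , greatest) = argmax (λ _ → true) L (i0 , refl) in x , λ y → greatest y refl

    lastLump : ℕ
    lastLump = L (proj₁ last)

    L≤lastLump : ∀ x → L x ≤ℕ lastLump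
    L≤lastLump = proj₂ last

    inhabited : ∀ {t} → t ≤ℕ lastLump → ∃ λ x → L x ≡ t
    inhabited {t} t≤lastLump with t ℕ.≟ lastLump
    ... | yes refl = proj₁ last , refl
    ... | no  t≢lastLump  = Composition.noGaps F (proj₁ last) t (ℕP.≤∧≢⇒< t≤lastLump t≢lastLump)

    r : ℕ → Fin n
    r t with lem {∃ λ x → L x ≡ t}
    ... | yes (x , _) = x
    ... | no  _       = i0

    L-r : ∀ {t} → t ≤ℕ lastLump → L (r t) ≡ t
    L-r {t} t≤lastLump with lem {∃ λ x → L x ≡ t}
    ... | yes (_ , Lx≡t) = Lx≡t
    ... | no  none       = ⊥-elim (none (inhabited t≤lastLump))

    rep : Fin n → Fin n
    rep x = r (L x)

    L-rep : ∀ x → L (rep x) ≡ L x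
    L-rep x = L-r (L≤lastLump x)

    highVector : Fin n → Fin n → ℚ
    highVector y x = δ y 1ℚ x - δ (rep y) 1ℚ x

    lowVector : List Bool → ℕ → Fin n → ℚ
    lowVector s t x = sign (signAt s t) * (δ (r t) 1ℚ x - δ (r (suc t)) 1ℚ x)

    vectors : List Bool → List (Fin n → ℚ)
    vectors s = tabulate highVector ++ applyUpTo (lowVector s) lastLump

    point : List Bool → Fin n → ℚ
    point s x = expand (map (λ v → v x) (vectors s))

    highDigits : Subset n → List ℚ
    highDigits V = map (subsetSum V) (tabulate highVector)

    lowDigits : List Bool → Subset n → List ℚ
    lowDigits s V = map (subsetSum V) (applyUpTo (lowVector s) lastLump)

    subsetSum-point : ∀ s V → subsetSum V (point s) ≡ expand (highDigits V ++ lowDigits s V)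
    subsetSum-point s V = trans (subsetSum-expand V (vectors s))
                                (cong expand (ListP.map-++ (subsetSum V) (tabulate highVector) _))

    highDigit : ∀ V y → subsetSum V (highVector y) ≡ bit (V y) - bit (V (rep y))
    highDigit V y =
      trans (subsetSum-sub V (δ y 1ℚ) (δ (rep y) 1ℚ)) (cong₂ _-_ (subsetSum-δ V y 1ℚ) (subsetSum-δ V (rep y) 1ℚ))

    lowDigit : ∀ s V t → subsetSum V (lowVector s t) ≡ sign (signAt s t) * (bit (V (r t)) - bit (V (r (suc t))))
    lowDigit s V t =
      trans (subsetSum-* V (sign (signAt s t)) (λ x → δ (r t) 1ℚ x - δ (r (suc t)) 1ℚ x))
            (cong (sign (signAt s t) *_) (trans (subsetSum-sub V (δ (r t) 1ℚ) (δ (r (suc t)) 1ℚ))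
                                                (cong₂ _-_ (subsetSum-δ V (r t) 1ℚ) (subsetSum-δ V (r (suc t)) 1ℚ))))

    lowDigit-same : ∀ s V t → V (r t) ≡ V (r (suc t)) → subsetSum V (lowVector s t) ≡ 0ℚ
    lowDigit-same s V t same =
      trans (lowDigit s V t) (trans (cong (sign (signAt s t) *_) (bit-≡ same)) (ℚP.*-zeroʳ (sign (signAt s t))))

    high-trits : ∀ V → All Trit (highDigits V)
    high-trits V = AllP.map⁺ (AllP.tabulate⁺ λ y → subst Trit (sym (highDigit V y)) (trit-bit- (V y) (V (rep y))))

    trits : ∀ s V → All Trit (highDigits V ++ lowDigits s V)
    trits s V = AllP.++⁺ (high-trits V) (AllP.map⁺ (AllP.applyUpTo⁺₂ _ lastLump low-trit))
      where
      low-trit : ∀ t → Trit (subsetSum V (lowVector s t))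
      low-trit t = subst Trit (sym (lowDigit s V t)) (trit-sign* (signAt s t) (V (r t)) (V (r (suc t))))

    IsUnionOfLumps : Subset n → Set
    IsUnionOfLumps V = ∀ x → V x ≡ V (rep x)

    union⇒high-zero : ∀ {V} → IsUnionOfLumps V → All (_≡ 0ℚ) (highDigits V)
    union⇒high-zero {V} union = AllP.map⁺ (AllP.tabulate⁺ λ y → trans (highDigit V y) (bit-≡ (union y)))

    ¬union⇒high-leading : ∀ {V} → ¬ IsUnionOfLumps V → First (_≡ 0ℚ) (_≢ 0ℚ) (highDigits V)
    ¬union⇒high-leading {V} ¬union =
      FirstP.¬All⇒First (ℚP._≟ 0ℚ) (λ ≢0 → ≢0) λ zero →
        ¬union λ y → by-contradiction (AllP.tabulate⁻ (AllP.map⁻ zero) y)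
      where
      by-contradiction : ∀ {y} → subsetSum V (highVector y) ≡ 0ℚ → V y ≡ V (rep y)
      by-contradiction {y} e with V y ≟ᵇ V (rep y)
      ... | yes Vy≡ = Vy≡
      ... | no  Vy≢ = ⊥-elim (bit-≢ Vy≢ (trans (sym (highDigit V y)) e))

    point-sum : ∀ s → InT (point s)
    point-sum s = trans (subsetSum-point s (λ _ → true))
                        (expand-zeros (AllP.++⁺ (union⇒high-zero (λ _ → refl))
                                                (AllP.map⁺ (AllP.applyUpTo⁺₂ _ lastLump λ t → lowDigit-same s _ t refl))))

    lump-change : ∀ {V} → IsUnionOfLumps V → ProperNonempty V →
      ∃ λ t → t <ℕ lastLump × (∀ t′ → t′ ≤ℕ t → V (r t′) ≡ V (r 0)) × V (r (suc t)) ≢ V (r 0)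
    lump-change {V} union ((a , Va) , (b , Vb)) =
      let (t , t<Lw , before , after) = first-change same-as-first (L w) (dec-true (V (r 0) ≟ᵇ V (r 0)) refl) w-differs
      in t , ℕP.<-≤-trans t<Lw (L≤lastLump w) , (λ t′ t′≤t → from-does (V (r t′) ≟ᵇ V (r 0)) (before t′ t′≤t)) ,
         from-does¬ (V (r (suc t)) ≟ᵇ V (r 0)) after
      where
      same-as-first : ℕ → Bool
      same-as-first t = does (V (r t) ≟ᵇ V (r 0))
      w : Fin n
      w = if V (r 0) then b else a
      w-differs : same-as-first (L w) ≡ false
      w-differs with V (r 0)
      ... | true  = dec-false (V (r (L b)) ≟ᵇ true) (λ e → true≢false (trans (sym e) (trans (sym (union b)) Vb)))
      ... | false = dec-false (V (r (L a)) ≟ᵇ false) (λ e → true≢false (trans (sym Va) (trans (union a) e)))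

    union-leading : ∀ {V} s → IsUnionOfLumps V → ProperNonempty V →
      First (_≡ 0ℚ) (_≢ 0ℚ) (highDigits V ++ lowDigits s V)
    union-leading {V} s union proper with lump-change union proper
    ... | t , t<K , before , after =
      FirstP.++⁺ (union⇒high-zero union) (FirstP.map⁺ (first-applyUpTo (lowVector s) t<K
        (λ t′ t′<t → lowDigit-same s V t′ (trans (before t′ (ℕP.<⇒≤ t′<t)) (sym (before (suc t′) t′<t))))
        (λ e → sign*bit-≢ (signAt s t) (λ e′ → after (trans (sym e′) (before t ℕP.≤-refl)))
                                       (trans (sym (lowDigit s V t)) e))))

    point-generic : ∀ s → Generic (point s)
    point-generic s = point-sum s , nonzero
      where
      nonzero : ∀ V → ProperNonempty V → subsetSum V (point s) ≢ 0ℚ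
      nonzero V proper e with lem {IsUnionOfLumps V}
      ... | no ¬union = expand≢0 (trits s V) (FirstP.⁺++ (¬union⇒high-leading ¬union) _) (trans (sym (subsetSum-point s V)) e)
      ... | yes union = expand≢0 (trits s V) (union-leading s union proper) (trans (sym (subsetSum-point s V)) e)

    ¬union-sign : ∀ {V} s s′ → ¬ IsUnionOfLumps V → 0ℚ < subsetSum V (point s) → 0ℚ < subsetSum V (point s′)
    ¬union-sign {V} s s′ ¬union pos with leading-sign (high-trits V) (¬union⇒high-leading ¬union)
    ... | inj₁ high-pos =
      subst (0ℚ <_) (sym (subsetSum-point s′ V)) (expand-pos (trits s′ V) (FirstP.⁺++ high-pos _))
    ... | inj₂ high-neg =
      ⊥-elim (ℚP.<-asym pos (subst (_< 0ℚ) (sym (subsetSum-point s V)) (expand-neg (trits s V) (FirstP.⁺++ high-neg _))))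

    FirstChange : Subset n → ℕ → Set
    FirstChange V t = t <ℕ lastLump × (∀ t′ → t′ ≤ℕ t → V (r t′) ≡ true) × V (r (suc t)) ≡ false

    first-change-leading : ∀ {V t} s → IsUnionOfLumps V → FirstChange V t →
      First (_≡ 0ℚ) (_≡ sign (signAt s t)) (highDigits V ++ lowDigits s V)
    first-change-leading {V} {t} s union (t<K , before , after) =
      FirstP.++⁺ (union⇒high-zero union) (FirstP.map⁺ (first-applyUpTo (lowVector s) t<K
        (λ t′ t′<t → lowDigit-same s V t′ (trans (before t′ (ℕP.<⇒≤ t′<t)) (sym (before (suc t′) t′<t))))
        (trans (lowDigit s V t) (trans (cong₂ (λ a b → sign (signAt s t) * (bit a - bit b)) (before t ℕP.≤-refl) after)
                                       (ℚP.*-identityʳ _)))))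

    union-sign⇒ : ∀ {V t} s → IsUnionOfLumps V → FirstChange V t → 0ℚ < subsetSum V (point s) → signAt s t ≡ true
    union-sign⇒ {V} {t} s union change pos with signAt s t in st
    ... | true  = refl
    ... | false = ⊥-elim (ℚP.<-asym pos (subst (_< 0ℚ) (sym (subsetSum-point s V)) (expand-neg (trits s V) leading)))
      where
      leading : First (_≡ 0ℚ) (_≡ - 1ℚ) (highDigits V ++ lowDigits s V)
      leading = subst (λ b → First (_≡ 0ℚ) (_≡ sign b) _) st (first-change-leading s union change)

    union-sign⇐ : ∀ {V t} s → IsUnionOfLumps V → FirstChange V t → signAt s t ≡ true → 0ℚ < subsetSum V (point s)
    union-sign⇐ {V} {t} s union change st =
      subst (0ℚ <_) (sym (subsetSum-point s V))
        (expand-pos (trits s V) (subst (λ b → First (_≡ 0ℚ) (_≡ sign b) _) st (first-change-leading s union change)))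

module Independence where

  open Sums
  open Counting
  open Classical
  open Cones
  open Indicators
  open TestPoints
  open import Level using (0ℓ)
  open import Axiom.ExcludedMiddle using (ExcludedMiddle)
  open import Data.Nat as ℕ using (ℕ; zero; suc; z≤n) renaming (_<_ to _<ℕ_; _≤_ to _≤ℕ_)
  import Data.Nat.Properties as ℕP
  open import Data.Fin using (Fin)
  open import Data.Bool using (true; false)
  import Data.Fin.Properties as FinP
  open import Data.Product using (∃; _×_; _,_; proj₁; proj₂)
  open import Data.Sum using (_⊎_; inj₁; inj₂)
  open import Data.Empty using (⊥; ⊥-elim)
  open import Data.List using (List; [])
  open import Data.List.Membership.Propositional using (_∈_)
  open import Relation.Nullary using (¬_; yes; no)
  open import Relation.Binary.PropositionalEquality
  open import Data.Rational using (0ℚ; _<_)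

  module Triangularity (lem : ExcludedMiddle 0ℓ) {n} (F : Composition n) (i0 : Fin n)
                       (F-i0 : Composition.lump F i0 ≡ 0) (G : Composition n) where
    open TestPoints.ForComposition lem F i0 F-i0

    LG : Fin n → ℕ
    LG = Composition.lump G

    NonUnionsPositive : Set
    NonUnionsPositive =
      ∀ V → ProperNonempty V → IsUpset (toPreposet G) V → ¬ IsUnionOfLumps V → 0ℚ < subsetSum V (point [])

    CutAfter : ℕ → Set
    CutAfter t = ∃ λ V → ProperNonempty V × IsUpset (toPreposet G) V × IsUnionOfLumps V × FirstChange V t

    positive⇒ : ∀ s → Positive (toPreposet G) (point s) → NonUnionsPositive × Forces lastLump CutAfter s
    positive⇒ s pos = (λ V proper V↑ ¬union → ¬union-sign s [] ¬union (pos V proper V↑)) ,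
                      (λ t t<lastLump (V , proper , V↑ , union , change) → union-sign⇒ s union change (pos V proper V↑))

    -- a nonempty upset of G contains i0, hence lump 0 of F if it is a union of lumps of F
    positive⇐ : LG i0 ≡ 0 → ∀ s → NonUnionsPositive × Forces lastLump CutAfter s →
      Positive (toPreposet G) (point s)
    positive⇐ G-i0 s (nonunions , forced) V proper V↑ with lem {IsUnionOfLumps V}
    ... | no  ¬union = ¬union-sign [] s ¬union (nonunions V proper V↑ ¬union)
    ... | yes union with proj₁ proper | proj₂ proper
    ...   | v , Vv | b , Vb with first-change (λ t → V (r t)) (L b) r0∈V (trans (sym (union b)) Vb)
      where
      r0∈V : V (r 0) ≡ true
      r0∈V = trans (cong (λ k → V (r k)) (sym F-i0))
                   (trans (sym (union i0)) (V↑ v i0 Vv (subst (_≤ℕ LG v) (sym G-i0) z≤n)))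
    ...     | t , t<Lb , before , after =
      union-sign⇐ s union change (forced t (proj₁ change) (V , proper , V↑ , union , change))
      where
      change : FirstChange V t
      change = ℕP.<-≤-trans t<Lb (L≤lastLump b) , before , after

    Full : Set
    Full = NonUnionsPositive × Always lastLump CutAfter

    upsets-nested : ∀ {V W} → IsUpset (toPreposet G) V → IsUpset (toPreposet G) W →
      ∀ {a b} → V a ≡ true → W a ≡ false → W b ≡ true → V b ≡ false → ⊥
    upsets-nested V↑ W↑ {a} {b} Va Wa Wb Vb with LG a ℕ.≤? LG b
    ... | yes a≤b = true≢false (trans (sym (W↑ b a Wb a≤b)) Wa)
    ... | no  a≰b = true≢false (trans (sym (V↑ a b Va (ℕP.<⇒≤ (ℕP.≰⇒> a≰b)))) Vb)

    -- if y were in a later lump of F than x although y ≥ x in G, the cut after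
    -- the lump of x and the cut before the lump of y would not be nested
    full⇒G⊆F : Full → ∀ x y → LG y ≤ℕ LG x → L y ≤ℕ L x
    full⇒G⊆F (_ , cuts) x y y≤x with L y ℕ.≤? L x
    ... | yes ok  = ok
    ... | no  y≰x with cuts (L x) (ℕP.<-≤-trans (ℕP.≰⇒> y≰x) (L≤lastLump y))
    ...   | V , _ , V↑ , V-union , (_ , V-upto , V-after) = ⊥-elim (by-lump-of-y (L y) refl)
      where
      x<y : L x <ℕ L y
      x<y = ℕP.≰⇒> y≰x
      Vy : V y ≡ true
      Vy = V↑ x y (trans (V-union x) (V-upto (L x) ℕP.≤-refl)) y≤x
      by-lump-of-y : ∀ k → L y ≡ k → ⊥
      by-lump-of-y zero    Ly≡0  = ℕP.<-irrefl refl (ℕP.<-≤-trans (subst (L x <ℕ_) Ly≡0 x<y) z≤n)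
      by-lump-of-y (suc u) Ly≡su with u ℕ.≟ L x | cuts u (subst (_≤ℕ lastLump) Ly≡su (L≤lastLump y))
      ... | yes u≡x | _ =
        true≢false (trans (sym Vy)
                          (trans (V-union y) (trans (cong (λ k → V (r k)) (trans Ly≡su (cong suc u≡x))) V-after)))
      ... | no  u≢x | W , _ , W↑ , W-union , (_ , W-upto , W-after) =
        upsets-nested V↑ W↑ Vy (trans (W-union y) (trans (cong (λ k → W (r k)) Ly≡su) W-after))
                               (W-upto (suc (L x)) x<u) V-after
        where
        x<u : L x <ℕ u
        x<u = ℕP.≤∧≢⇒< (ℕP.≤-pred (subst (L x <ℕ_) Ly≡su x<y)) (λ e → u≢x (sym e))

    G⊆F⇒L≤LG : (∀ x y → LG y ≤ℕ LG x → L y ≤ℕ L x) → ∀ x → L x ≤ℕ LG x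
    G⊆F⇒L≤LG G⊆F x = by-lump (L x) x refl
      where
      by-lump : ∀ k x → L x ≡ k → L x ≤ℕ LG x
      by-lump zero    x Lx≡0  = subst (_≤ℕ LG x) (sym Lx≡0) z≤n
      by-lump (suc k) x Lx≡sk with Composition.noGaps F x k (subst (k <ℕ_) (sym Lx≡sk) (ℕP.n<1+n k))
      ... | j , Lj≡k =
        subst (_≤ℕ LG x) (sym Lx≡sk) (ℕP.≤-<-trans (subst (_≤ℕ LG j) Lj≡k (by-lump k j Lj≡k)) LGj<LGx)
        where
        LGj<LGx : LG j <ℕ LG x
        LGj<LGx with LG x ℕ.≤? LG j
        ... | no  x≰j = ℕP.≰⇒> x≰j
        ... | yes x≤j =
          ⊥-elim (ℕP.<-irrefl refl (ℕP.<-≤-trans (subst₂ _<ℕ_ (sym Lj≡k) (sym Lx≡sk) (ℕP.n<1+n k)) (G⊆F j x x≤j)))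

    full⇒ : Full → (F ≐ G) ⊎ sumℕ L <ℕ sumℕ LG
    full⇒ full with lem {F ≐ G}
    ... | yes F≐G = inj₁ F≐G
    ... | no  F≉G with FinP.¬∀⟶∃¬ n _ (λ i → L i ℕ.≟ LG i) F≉G
    ...   | x , Lx≢LGx = inj₂ (sumℕ-strict L≤LG x (ℕP.≤∧≢⇒< (L≤LG x) Lx≢LGx))
      where
      L≤LG : ∀ x → L x ≤ℕ LG x
      L≤LG = G⊆F⇒L≤LG (full⇒G⊆F full)

  full-self : ∀ (lem : ExcludedMiddle 0ℓ) {n} (F : Composition n) (i0 : Fin n) (F-i0 : Composition.lump F i0 ≡ 0) →
    Triangularity.Full lem F i0 F-i0 F
  full-self lem F i0 F-i0 = (λ V proper V↑ ¬union → ⊥-elim (¬union (upset-union V↑))) , initial-segment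
    where
    open TestPoints.ForComposition lem F i0 F-i0
    upset-union : ∀ {V} → IsUpset (toPreposet F) V → IsUnionOfLumps V
    upset-union {V} V↑ x with V x in Vx | V (rep x) in Vrx
    ... | true  | true  = refl
    ... | false | false = refl
    ... | true  | false = ⊥-elim (true≢false (trans (sym (V↑ x (rep x) Vx (ℕP.≤-reflexive (L-rep x)))) Vrx))
    ... | false | true  = ⊥-elim (true≢false (trans (sym (V↑ (rep x) x Vrx (ℕP.≤-reflexive (sym (L-rep x))))) Vx))
    upTo : ℕ → Subset _
    upTo t x = Relation.Nullary.does (L x ℕ.≤? t)
    initial-segment : Always lastLump (Triangularity.CutAfter lem F i0 F-i0 F)
    initial-segment t t<K = upTo t , proper , upset , union , (t<K , before , after)
      where
      open import Relation.Nullary.Decidable using (dec-true; dec-false)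
      next∉ : ¬ L (r (suc t)) ≤ℕ t
      next∉ le = ℕP.<-irrefl refl (ℕP.<-≤-trans (ℕP.n<1+n t) (subst (_≤ℕ t) (L-r t<K) le))
      proper : ProperNonempty (upTo t)
      proper = (i0 , dec-true (L i0 ℕ.≤? t) (subst (_≤ℕ t) (sym F-i0) z≤n)) ,
               (r (suc t) , dec-false (L (r (suc t)) ℕ.≤? t) next∉)
      upset : IsUpset (toPreposet F) (upTo t)
      upset x y x∈ y≤x = dec-true (L y ℕ.≤? t) (ℕP.≤-trans y≤x (from-does (L x ℕ.≤? t) x∈))
      union : IsUnionOfLumps (upTo t)
      union x = cong (λ k → Relation.Nullary.does (k ℕ.≤? t)) (sym (L-rep x))
      before : ∀ t′ → t′ ≤ℕ t → upTo t (r t′) ≡ true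
      before t′ t′≤t =
        dec-true (L (r t′) ℕ.≤? t) (subst (_≤ℕ t) (sym (L-r (ℕP.≤-trans t′≤t (ℕP.<⇒≤ t<K)))) t′≤t)
      after : upTo t (r (suc t)) ≡ false
      after = dec-false (L (r (suc t)) ℕ.≤? t) next∉

module LinearIndependence where

  open Counting using (sumℕ)
  open Indicators
  open TestPoints
  open Independence
  open import Level using (0ℓ)
  open import Axiom.ExcludedMiddle using (ExcludedMiddle)
  open import Data.Nat as ℕ using (ℕ; _∸_; _⊔_)
  import Data.Nat.Properties as ℕP
  open import Data.Nat.Induction using (<-rec)
  open import Data.Fin using (Fin)
  open import Data.Bool using (Bool)
  open import Data.Product using (_×_; _,_; proj₁; proj₂)
  open import Data.Sum using (_⊎_; inj₁; inj₂)
  open import Data.Empty using (⊥-elim)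
  open import Data.List using (List; []; _∷_; foldr)
  open import Data.List.Relation.Unary.All as All using (All)
  open import Data.List.Relation.Unary.AllPairs using (AllPairs)
  open import Data.List.Relation.Unary.Any using (here; there)
  open import Data.List.Membership.Propositional using (_∈_)
  open import Relation.Nullary using (¬_; Dec; yes; no)
  import Relation.Binary.PropositionalEquality as ≡
  open import Data.Rational using (ℚ)

  module _ {c ℓ} (𝔽 : CharZeroField c ℓ) (lem : ExcludedMiddle 0ℓ) where
    open CharZeroField 𝔽 hiding (zero)
    open import Algebra.Properties.CommutativeSemigroup *-commutativeSemigroup using (x∙yz≈y∙xz)

    ∑-sgn-combo : ∀ {n} k (L : List (Composition n × Carrier)) (hs : List Bool → Fin n → ℚ) →
      ∑ 𝔽 lem (signs k) (λ s → sgn 𝔽 lem s * combo 𝔽 lem L (hs s))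
        ≈ ∑ 𝔽 lem L (λ (G , b) → b * ∑ 𝔽 lem (signs k) (λ s → sgn 𝔽 lem s * č 𝔽 lem (toPreposet G) (hs s)))
    ∑-sgn-combo k []            hs = ∑-0 𝔽 lem (signs k) (λ {s} _ → zeroʳ (sgn 𝔽 lem s))
    ∑-sgn-combo k ((G , b) ∷ L) hs =
      trans (∑-cong 𝔽 lem (signs k) (λ {s} _ → trans (distribˡ _ _ _) (+-cong (x∙yz≈y∙xz _ _ _) refl)))
            (trans (∑-+ 𝔽 lem (signs k) _ _) (+-cong (∑-*ˡ 𝔽 lem (signs k) b _) (∑-sgn-combo k L hs)))

    module _ {n} (i0 : Fin n) (F : Composition n) (F-i0 : Composition.lump F i0 ≡.≡ 0) where
      open TestPoints.ForComposition lem F i0 F-i0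

      ∑-sgn-č : ∀ G → Composition.lump G i0 ≡.≡ 0 →
        ∑ 𝔽 lem (signs lastLump) (λ s → sgn 𝔽 lem s * č 𝔽 lem (toPreposet G) (point s))
          ≈ 𝟙 𝔽 lem (Triangularity.Full lem F i0 F-i0 G)
      ∑-sgn-č G G-i0 =
        trans (∑-cong 𝔽 lem (signs lastLump) λ {s} _ →
                 *-cong refl (reflexive (≡.trans (č≡𝟙 𝔽 lem (toPreposet G) (point-generic s))
                                               (𝟙-cong 𝔽 lem (positive⇒ s) (positive⇐ G-i0 s)))))
              (∑-sgn-𝟙 𝔽 lem lastLump NonUnionsPositive CutAfter)
        where open Triangularity lem F i0 F-i0 G

    triangular : ∀ {A : Set} (_≐_ : A → A → Set) → (∀ {x y} → x ≐ y → y ≐ x) → (weight : A → ℕ) →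
      (L : List (A × Carrier)) (M : ∀ {x} → x ∈ L → A → Carrier) →
      AllPairs (λ x y → ¬ proj₁ x ≐ proj₁ y) L →
      (∀ {x} (x∈ : x ∈ L) → M x∈ (proj₁ x) ≈ 1#) →
      (∀ {x y} (x∈ : x ∈ L) → y ∈ L →
        M x∈ (proj₁ y) ≈ 0# ⊎ proj₁ x ≐ proj₁ y ⊎ weight (proj₁ x) ℕ.< weight (proj₁ y)) →
      (∀ {x} (x∈ : x ∈ L) → ∑ 𝔽 lem L (λ y → proj₂ y * M x∈ (proj₁ y)) ≈ 0#) →
      All (λ x → proj₂ x ≈ 0#) L
    triangular _≐_ ≐-sym weight L M distinct diagonal upper solution =
      All.tabulate (λ x∈ → <-rec Vanishes vanishes _ x∈ ≡.refl)
      where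
      top : ℕ
      top = foldr (λ x m → weight (proj₁ x) ⊔ m) 0 L
      weight≤top : ∀ {ys : List _} {y} → y ∈ ys → weight (proj₁ y) ℕ.≤ foldr (λ x m → weight (proj₁ x) ⊔ m) 0 ys
      weight≤top (here ≡.refl) = ℕP.m≤m⊔n _ _
      weight≤top (there y∈)    = ℕP.≤-trans (weight≤top y∈) (ℕP.m≤n⊔m _ _)
      Vanishes : ℕ → Set _
      Vanishes d = ∀ {x} → x ∈ L → top ∸ weight (proj₁ x) ≡.≡ d → proj₂ x ≈ 0#
      vanishes : ∀ d → (∀ {d′} → d′ ℕ.< d → Vanishes d′) → Vanishes d
      vanishes d IH {x , a} x∈ ≡.refl = begin
        a                                          ≈⟨ sym (*-identityʳ a) ⟩
        a * 1#                                     ≈⟨ *-cong refl (sym (diagonal x∈)) ⟩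
        a * M x∈ x                                 ≈⟨ sym (∑-single 𝔽 lem L _ distinct x∈ off-diagonal) ⟩
        ∑ 𝔽 lem L (λ y → proj₂ y * M x∈ (proj₁ y)) ≈⟨ solution x∈ ⟩
        0#                                         ∎
        where
        open import Relation.Binary.Reasoning.Setoid setoid
        off-diagonal : ∀ {y} → y ∈ L → (¬ x ≐ proj₁ y) ⊎ (¬ proj₁ y ≐ x) → proj₂ y * M x∈ (proj₁ y) ≈ 0#
        off-diagonal {G , b} G∈ distinct-G with upper x∈ G∈
        ... | inj₁ zero-entry = trans (*-cong refl zero-entry) (zeroʳ b)
        ... | inj₂ (inj₁ x≐G) with distinct-G
        ...   | inj₁ ¬x≐G = ⊥-elim (¬x≐G x≐G)
        ...   | inj₂ ¬G≐x = ⊥-elim (¬G≐x (≐-sym x≐G))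
        off-diagonal {G , b} G∈ _ | inj₂ (inj₂ heavier) =
          trans (*-cong (IH (ℕP.∸-monoʳ-< heavier (weight≤top G∈)) G∈ ≡.refl) refl) (zeroˡ _)

    independent : ∀ {n} (i0 : Fin n) (L : List (Composition n × Carrier)) →
      All (λ Fa → FirstLumpContains i0 (proj₁ Fa)) L →
      AllPairs (λ Fa Gb → ¬ (proj₁ Fa ≐ proj₁ Gb)) L →
      (∀ h → Generic h → combo 𝔽 lem L h ≈ 0#) →
      All (λ Fa → proj₂ Fa ≈ 0#) L
    independent {n} i0 L L∈Σ distinct vanishes =
      triangular _≐_ (λ F≐G i → ≡.sym (F≐G i)) (λ G → sumℕ (Composition.lump G)) L M
                 distinct diagonal upper solution
      where
      Full : ∀ {x} → x ∈ L → Composition n → Set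
      Full {F , _} x∈ = Triangularity.Full lem F i0 (All.lookup L∈Σ x∈)
      M : ∀ {x} → x ∈ L → Composition n → Carrier
      M x∈ G = 𝟙 𝔽 lem (Full x∈ G)
      diagonal : ∀ {x} (x∈ : x ∈ L) → M x∈ (proj₁ x) ≈ 1#
      diagonal {F , _} x∈ = reflexive (𝟙-yes 𝔽 lem (full-self lem F i0 (All.lookup L∈Σ x∈)))
      upper : ∀ {x y} (x∈ : x ∈ L) → y ∈ L →
        M x∈ (proj₁ y) ≈ 0# ⊎ proj₁ x ≐ proj₁ y
          ⊎ sumℕ (Composition.lump (proj₁ x)) ℕ.< sumℕ (Composition.lump (proj₁ y))
      upper {F , _} {G , _} x∈ _ = by-cases (lem {Full x∈ G})
        where
        by-cases : Dec (Full x∈ G) →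
          M x∈ G ≈ 0# ⊎ F ≐ G ⊎ sumℕ (Composition.lump F) ℕ.< sumℕ (Composition.lump G)
        by-cases (yes full) = inj₂ (Triangularity.full⇒ lem F i0 (All.lookup L∈Σ x∈) G full)
        by-cases (no ¬full) = inj₁ (reflexive (𝟙-no 𝔽 lem ¬full))
      solution : ∀ {x} (x∈ : x ∈ L) → ∑ 𝔽 lem L (λ y → proj₂ y * M x∈ (proj₁ y)) ≈ 0#
      solution {F , _} x∈ = begin
        ∑ 𝔽 lem L (λ y → proj₂ y * M x∈ (proj₁ y))
          ≈⟨ ∑-cong 𝔽 lem L (λ {(G , b)} G∈ → *-cong refl (sym (∑-sgn-č i0 F F-i0 G (All.lookup L∈Σ G∈)))) ⟩
        ∑ 𝔽 lem L (λ (G , b) → b * ∑ 𝔽 lem (signs lastLump) (λ s → sgn 𝔽 lem s * č 𝔽 lem (toPreposet G) (point s)))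
          ≈⟨ sym (∑-sgn-combo lastLump L point) ⟩
        ∑ 𝔽 lem (signs lastLump) (λ s → sgn 𝔽 lem s * combo 𝔽 lem L (point s))
          ≈⟨ ∑-0 𝔽 lem (signs lastLump) (λ {s} _ → trans (*-cong refl (vanishes (point s) (point-generic s))) (zeroʳ _)) ⟩
        0# ∎
        where
        open import Relation.Binary.Reasoning.Setoid setoid
        F-i0 = All.lookup L∈Σ x∈
        open TestPoints.ForComposition lem F i0 F-i0 using (lastLump; point; point-generic)

open LinearIndependence using (independent)
open Spanning using (č-spanned)

mainTheorem13 : ∀ {c ℓ} (K : CharZeroField c ℓ) (lem : ExcludedMiddle 0ℓ)
    (n : ℕ) (i0 : Fin n) →
    -- linear independence of {č_F : F ∈ Σ_{i0}[I]}
    (∀ (L : List (Composition n × CharZeroField.Carrier K)) →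
      All (λ Fa → FirstLumpContains i0 (proj₁ Fa)) L →
      AllPairs (λ Fa Gb → ¬ (proj₁ Fa ≐ proj₁ Gb)) L →
      (∀ (h : Fin n → ℚ) → Generic h →
        CharZeroField._≈_ K (combo K lem L h) (CharZeroField.0# K)) →
      All (λ Fa → CharZeroField._≈_ K (proj₂ Fa) (CharZeroField.0# K)) L)
    ×
    -- spanning: every č_p lies in the span of {č_F : F ∈ Σ_{i0}[I]}
    (∀ (p : Preposet n) →
      ∃ λ (L : List (Composition n × CharZeroField.Carrier K)) →
        All (λ Fa → FirstLumpContains i0 (proj₁ Fa)) L
        × (∀ (h : Fin n → ℚ) → Generic h →
            CharZeroField._≈_ K (č K lem p h) (combo K lem L h)))
mainTheorem13 K lem n i0 = independent K lem i0 , č-spanned K lem i0
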